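{- Let $n\ge1$, let $u,v_1,\dots,v_n\in S_{\mathbb{N}}$ and let $\mathbf{w}$ be any word over $S_{\mathbb{N}}$. Then in $(\mathcal{H},*)$, \begin{align*} (\mathbf{w},u)*(v_1,\dots,v_n)&=(\mathbf{w},u,v_1,\dots,v_n)+(\mathbf{w},u+v_1,v_2,\dots,v_n)\\ &\quad+\sum_{i=1}^{n}(-1)^{i-1}\sum_{\bullet_2,\dots,\bullet_i}(\{\mathbf{w}*(v_i\bullet_i\cdots\bullet_2v_1)\},u)*(v_{i+1},\dots,v_n), \end{align*} where the inner sum runs over all choices $\bullet_k\in\{\text{comma},+\}$, $2\le k\le i$ (for $i=1$ the term is $(\{\mathbf{w}*(v_1)\},u)*(v_2,\dots,v_n)$), and $(v_{n+1},\dots,v_n)=1$.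
   Context: Let $s_1,s_2,\dots$ be formal symbols and $S_{\mathbb{N}}$ the commutative semigroup of formal sums $\sum_i a_is_i$ ($a_i\in\mathbb{N}_0$, finitely many nonzero, not all zero). Words are finite sequences $(u_1,\dots,u_k)$ of elements of $S_{\mathbb{N}}$, including the empty word $1$; $\mathcal{H}$ is the $\mathbb{Q}$-vector space with basis the words. For $x=\sum c_\alpha\alpha\in\mathcal{H}$ and $u\in S_{\mathbb{N}}$, $(\{x\},u):=\sum c_\alpha(\alpha,u)$ (appending $u$). The harmonic product $*$ is the $\mathbb{Q}$-bilinear map with $\mathbf{w}*1=1*\mathbf{w}=\mathbf{w}$ and $(\mathbf{w}_1,u_1)*(\mathbf{w}_2,u_2)=(\{\mathbf{w}_1*(\mathbf{w}_2,u_2)\},u_1)+(\{(\mathbf{w}_1,u_1)*\mathbf{w}_2\},u_2)+(\{\mathbf{w}_1*\mathbf{w}_2\},u_1+u_2)$; it makes $\mathcal{H}$ a commutative associative unital algebra. $(v_i\bullet_i\cdots\bullet_2v_1)$ denotes the word obtained by listing $v_i,\dots,v_1$ in this order and, between consecutive $v_k,v_{k-1}$, either separating them ($\bullet_k$ = comma) or adding them into a single letter ($\bullet_k=+$). -}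

module Defs where

open import Data.Nat as ℕ using (ℕ; zero; suc)
open import Data.Rational as ℚ using (ℚ; 0ℚ; 1ℚ; -_)
open import Data.List using (List; []; _∷_; _++_; map; concat; take; drop; reverse; length; upTo)
open import Data.Product using (_×_; _,_)
open import Relation.Nullary using (Dec; yes; no)
open import Relation.Binary.PropositionalEquality using (_≡_; refl; cong; cong₂)

-- The semigroup S_ℕ of nonzero formal sums Σ a_i s_i (a_i ∈ ℕ₀).
-- Canonical (proof-free) representation by the coefficient sequence
-- a_1, a_2, ..., a_k, where the LAST nonzero coefficient a_k is stored
-- as its predecessor:
--   last a     ↦  (suc a) s_1
--   a ∷ x      ↦  a s_1 + (shift of x to the symbols s_2, s_3, ...)
-- Every element of S_ℕ has exactly one representation.

data S : Set where
  last : ℕ → S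
  _∷_  : ℕ → S → S

infixr 5 _∷_

_⊕_ : S → S → S
last a   ⊕ last b   = last (suc (a ℕ.+ b))
last a   ⊕ (b ∷ y)  = (suc a ℕ.+ b) ∷ y
(a ∷ x)  ⊕ last b   = (a ℕ.+ suc b) ∷ x
(a ∷ x)  ⊕ (b ∷ y)  = (a ℕ.+ b) ∷ (x ⊕ y)

infixl 6 _⊕_

-- the symbol s_i (i ≥ 1), given as s (i-1)
s : ℕ → S
s zero    = last 0
s (suc i) = 0 ∷ s i

-- Words: finite sequences over S_ℕ, built by appending letters on the
-- right, as in the paper's notation (w , u).

data Word : Set where
  ε   : Word
  _,,_ : Word → S → Word

infixl 5 _,,_

_++ʷ_ : Word → List S → Word
w ++ʷ []       = w
w ++ʷ (u ∷ us) = (w ,, u) ++ʷ us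

word : List S → Word
word vs = ε ++ʷ vs

-- ℋ : the ℚ-vector space with basis the words.  An element is
-- represented by a finite formal ℚ-linear combination (list of
-- coefficient/word pairs); two representations denote the same element
-- iff all coefficients agree (see coeff and _≈ℋ_ below).

ℋ : Set
ℋ = List (ℚ × Word)

⟦_⟧ : Word → ℋ
⟦ w ⟧ = (1ℚ , w) ∷ []

_+ℋ_ : ℋ → ℋ → ℋ
_+ℋ_ = _++_

infixl 6 _+ℋ_

_·ℋ_ : ℚ → ℋ → ℋ
q ·ℋ x = map (λ { (c , α) → (q ℚ.* c , α) }) x

infixr 7 _·ℋ_

sumℋ : List ℋ → ℋ
sumℋ = concat

⟨_,_⟩ : ℋ → S → ℋ
⟨ x , u ⟩ = map (λ { (c , α) → (c , (α ,, u)) }) x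

_⋆ʷ_ : Word → Word → ℋ
w ⋆ʷ ε = ⟦ w ⟧
ε ⋆ʷ w = ⟦ w ⟧
(w₁ ,, u₁) ⋆ʷ (w₂ ,, u₂) =
      ⟨ w₁ ⋆ʷ (w₂ ,, u₂) , u₁ ⟩
  +ℋ ⟨ (w₁ ,, u₁) ⋆ʷ w₂ , u₂ ⟩
  +ℋ ⟨ w₁ ⋆ʷ w₂ , u₁ ⊕ u₂ ⟩

_⋆_ : ℋ → ℋ → ℋ
x ⋆ y = concat (map (λ { (c , α) →
          concat (map (λ { (d , β) → (c ℚ.* d) ·ℋ (α ⋆ʷ β) }) y) }) x)

infixl 7 _⋆_

suc-inj : ∀ {a b : ℕ} → suc a ≡ suc b → a ≡ b
suc-inj refl = refl

_≟S_ : (x y : S) → Dec (x ≡ y)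
last a ≟S last b with a ℕ.≟ b
... | yes refl = yes refl
... | no ne = no (λ { refl → ne refl })
last a ≟S (b ∷ y) = no (λ ())
(a ∷ x) ≟S last b = no (λ ())
(a ∷ x) ≟S (b ∷ y) with a ℕ.≟ b | x ≟S y
... | yes refl | yes refl = yes refl
... | no ne | _ = no (λ { refl → ne refl })
... | yes _ | no ne = no (λ { refl → ne refl })

_≟W_ : (x y : Word) → Dec (x ≡ y)
ε ≟W ε = yes refl
ε ≟W (y ,, v) = no (λ ())
(x ,, u) ≟W ε = no (λ ())
(x ,, u) ≟W (y ,, v) with x ≟W y | u ≟S v
... | yes refl | yes refl = yes refl
... | no ne | _ = no (λ { refl → ne refl })
... | yes _ | no ne = no (λ { refl → ne refl })

coeff : ℋ → Word → ℚ
coeff [] α = 0ℚ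
coeff ((c , β) ∷ x) α with β ≟W α
... | yes _ = c ℚ.+ coeff x α
... | no _  = coeff x α

_≈ℋ_ : ℋ → ℋ → Set
x ≈ℋ y = ∀ α → coeff x α ≡ coeff y α

infix 4 _≈ℋ_

-- (v_i •_i ⋯ •_2 v_1): given the letters listed in the order
-- a₀ = v_i, a₁ = v_{i-1}, ..., the list of all 2^{i-1} words obtained by
-- choosing, between consecutive letters, comma or +.

merges′ : S → List S → List (List S)
merges′ a []       = (a ∷ []) ∷ []
merges′ a (b ∷ r)  = map (a ∷_) (merges′ b r)
                  ++ merges′ (a ⊕ b) r

merges : List S → List (List S)
merges []      = [] ∷ []
merges (a ∷ r) = merges′ a r

sign : ℕ → ℚ
sign zero    = 1ℚ
sign (suc k) = - sign k

rhs : Word → S → List S → ℋ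
rhs w u [] = []
rhs w u (v₁ ∷ vs) =
     ⟦ (w ,, u) ++ʷ (v₁ ∷ vs) ⟧
  +ℋ ⟦ (w ,, (u ⊕ v₁)) ++ʷ vs ⟧
  +ℋ sumℋ (map (λ k →                       -- i = k + 1 ∈ {1,…,n}
        sign k ·ℋ
          sumℋ (map (λ m → ⟨ ⟦ w ⟧ ⋆ ⟦ word m ⟧ , u ⟩ ⋆ ⟦ word (drop (suc k) V) ⟧)
                    (merges (reverse (take (suc k) V)))))
       (upTo (length V)))
  where
    V : List S
    V = v₁ ∷ vs

module Submission where

-- Everything is proved up to _≃_, which identifies two elements of ℋ when every linear form
-- ⟪ f ⟫ takes the same value on them; the forms δ α recover _≈ℋ_.  Besides its defining
-- recursion on last letters, the harmonic product is associative and satisfies the mirror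
-- recursion on first letters (◁-⋆ʷ-◁).  Let Φᵢ = Σ (vᵢ •ᵢ ⋯ •₂ v₁) be the sum of all merges.  By
-- the first-letter recursion, Φᵢ * (vᵢ₊₁, …, vₙ) = Aᵢ + Aᵢ₊₁, where Aᵢ collects the words
-- whose first letter is, unmerged, the first letter of a merge in Φᵢ; so the alternating sum
-- Σᵢ (-1)ⁱ⁻¹ Φᵢ * (vᵢ₊₁, …, vₙ) telescopes to A₁ = (v₁, …, vₙ).  The proposition follows by
-- induction on n: expand (w, u) * (V, v) by the last-letter recursion and rewrite w * (V, v)
-- and w * V with the telescoped identity multiplied on the left by w.

open import Defs
open import Algebra.Bundles using (CommutativeMonoid)
open import Algebra.Structures using (IsCommutativeMonoid)
import Algebra.Properties.CommutativeSemigroup as CommutativeSemigroupProperties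
open import Data.Nat using (ℕ; suc) renaming (_+_ to _+ℕ_)
import Data.Nat.Properties as ℕ
open import Data.Rational using (ℚ; 0ℚ; 1ℚ; -_; _+_; _*_)
import Data.Rational.Properties as ℚ
open import Data.List
  using (List; []; _∷_; _++_; map; concat; take; drop; reverseAcc; length; upTo; applyUpTo; _∷ʳ_)
import Data.List.Properties as List
open import Data.List.Reverse using (Reverse; []; _∶_∶ʳ_; reverseView)
open import Data.Product using (_,_; proj₁; proj₂; map₂)
open import Function using (_∘_; id)
open import Level using (0ℓ)
open import Relation.Nullary using (yes; no)
import Relation.Binary.Reasoning.Setoid
open import Relation.Binary.PropositionalEquality
  using (_≡_; refl; sym; trans; cong; cong₂; module ≡-Reasoning)

module ℚ+ = CommutativeSemigroupProperties (CommutativeMonoid.commutativeSemigroup ℚ.+-0-commutativeMonoid)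
module ℚ* = CommutativeSemigroupProperties (CommutativeMonoid.commutativeSemigroup ℚ.*-1-commutativeMonoid)

-1*q≡-q : ∀ q → (- 1ℚ) * q ≡ - q
-1*q≡-q q = trans (sym (ℚ.neg-distribˡ-* 1ℚ q)) (cong -_ (ℚ.*-identityˡ q))

⊕-comm : ∀ x y → x ⊕ y ≡ y ⊕ x
⊕-comm (last a) (last b) = cong (last ∘ suc) (ℕ.+-comm a b)
⊕-comm (last a) (b ∷ y)  = cong (_∷ y) (ℕ.+-comm (suc a) b)
⊕-comm (a ∷ x)  (last b) = cong (_∷ x) (ℕ.+-comm a (suc b))
⊕-comm (a ∷ x)  (b ∷ y)  = cong₂ _∷_ (ℕ.+-comm a b) (⊕-comm x y)

⊕-assoc : ∀ x y z → (x ⊕ y) ⊕ z ≡ x ⊕ (y ⊕ z)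
⊕-assoc (last a) (last b) (last c) = cong (last ∘ suc) (trans (ℕ.+-assoc (suc a) b c) (sym (ℕ.+-suc a _)))
⊕-assoc (last a) (last b) (c ∷ z)  = cong ((_∷ z) ∘ suc) (trans (ℕ.+-assoc (suc a) b c) (sym (ℕ.+-suc a _)))
⊕-assoc (last a) (b ∷ y)  (last c) = cong (_∷ y) (ℕ.+-assoc (suc a) b (suc c))
⊕-assoc (last a) (b ∷ y)  (c ∷ z)  = cong (_∷ (y ⊕ z)) (ℕ.+-assoc (suc a) b c)
⊕-assoc (a ∷ x)  (last b) (last c) =
  cong (_∷ x) (trans (ℕ.+-assoc a (suc b) (suc c)) (cong ((a +ℕ_) ∘ suc) (ℕ.+-suc b c)))
⊕-assoc (a ∷ x)  (last b) (c ∷ z)  = cong (_∷ (x ⊕ z)) (ℕ.+-assoc a (suc b) c)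
⊕-assoc (a ∷ x)  (b ∷ y)  (last c) = cong (_∷ (x ⊕ y)) (ℕ.+-assoc a b (suc c))
⊕-assoc (a ∷ x)  (b ∷ y)  (c ∷ z)  = cong₂ _∷_ (ℕ.+-assoc a b c) (⊕-assoc x y z)

-- Linear forms on ℋ

private variable I J : Set

∑ : List I → (I → ℚ) → ℚ
∑ []       g = 0ℚ
∑ (a ∷ as) g = g a + ∑ as g

∑-cong : ∀ {g h : I → ℚ} as → (∀ a → g a ≡ h a) → ∑ as g ≡ ∑ as h
∑-cong []       e = refl
∑-cong (a ∷ as) e = cong₂ _+_ (e a) (∑-cong as e)

∑-++ : ∀ as bs (g : I → ℚ) → ∑ (as ++ bs) g ≡ ∑ as g + ∑ bs g
∑-++ []       bs g = sym (ℚ.+-identityˡ _)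
∑-++ (a ∷ as) bs g = trans (cong (g a +_) (∑-++ as bs g)) (sym (ℚ.+-assoc (g a) _ _))

∑-+ : ∀ as (g h : I → ℚ) → ∑ as (λ a → g a + h a) ≡ ∑ as g + ∑ as h
∑-+ []       g h = sym (ℚ.+-identityˡ 0ℚ)
∑-+ (a ∷ as) g h = trans (cong (g a + h a +_) (∑-+ as g h)) (ℚ+.interchange (g a) (h a) _ _)

∑-* : ∀ q as (g : I → ℚ) → ∑ as (λ a → q * g a) ≡ q * ∑ as g
∑-* q []       g = sym (ℚ.*-zeroʳ q)
∑-* q (a ∷ as) g = trans (cong (q * g a +_) (∑-* q as g)) (sym (ℚ.*-distribˡ-+ q _ _))

∑-0 : ∀ as → ∑ as (λ (_ : I) → 0ℚ) ≡ 0ℚ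
∑-0 []       = refl
∑-0 (a ∷ as) = trans (ℚ.+-identityˡ _) (∑-0 as)

∑-map : ∀ (k : J → I) bs (g : I → ℚ) → ∑ (map k bs) g ≡ ∑ bs (g ∘ k)
∑-map k []       g = refl
∑-map k (b ∷ bs) g = cong (g (k b) +_) (∑-map k bs g)

∑-concat : ∀ ass (g : I → ℚ) → ∑ (concat ass) g ≡ ∑ ass (λ as → ∑ as g)
∑-concat []         g = refl
∑-concat (as ∷ ass) g = trans (∑-++ as (concat ass) g) (cong (∑ as g +_) (∑-concat ass g))

∑-swap : ∀ as (bs : List J) (k : I → J → ℚ) →
         ∑ as (λ a → ∑ bs (k a)) ≡ ∑ bs (λ b → ∑ as (λ a → k a b))
∑-swap []       bs k = sym (∑-0 bs)
∑-swap (a ∷ as) bs k =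
  trans (cong (∑ bs (k a) +_) (∑-swap as bs k)) (sym (∑-+ bs (k a) (λ b → ∑ as (λ a → k a b))))

_▹_ : (Word → ℚ) → S → Word → ℚ
(f ▹ u) α = f (α ,, u)

δ : Word → Word → ℚ
δ α β with β ≟W α
... | yes _ = 1ℚ
... | no  _ = 0ℚ

-- Opaque so that ⟪ f ⟫ x stays rigid during unification.
opaque
  ⟪_⟫ : (Word → ℚ) → ℋ → ℚ
  ⟪ f ⟫ x = ∑ x (λ p → proj₁ p * f (proj₂ p))

  ⟪⟫-cong : ∀ {f g} x → (∀ α → f α ≡ g α) → ⟪ f ⟫ x ≡ ⟪ g ⟫ x
  ⟪⟫-cong x e = ∑-cong x (λ p → cong (proj₁ p *_) (e (proj₂ p)))

  ⟪⟫-+ : ∀ f g x → ⟪ (λ α → f α + g α) ⟫ x ≡ ⟪ f ⟫ x + ⟪ g ⟫ x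
  ⟪⟫-+ f g x = trans (∑-cong x (λ p → ℚ.*-distribˡ-+ (proj₁ p) _ _)) (∑-+ x _ _)

  ⟪⟫-swap : ∀ (k : Word → Word → ℚ) x y →
            ⟪ (λ α → ⟪ k α ⟫ y) ⟫ x ≡ ⟪ (λ β → ⟪ (λ α → k α β) ⟫ x) ⟫ y
  ⟪⟫-swap k x y = begin
    ∑ x (λ p → proj₁ p * ∑ y (λ q → proj₁ q * k (proj₂ p) (proj₂ q)))
      ≡⟨ ∑-cong x (λ p → sym (∑-* (proj₁ p) y _)) ⟩
    ∑ x (λ p → ∑ y (λ q → proj₁ p * (proj₁ q * k (proj₂ p) (proj₂ q))))
      ≡⟨ ∑-swap x y _ ⟩
    ∑ y (λ q → ∑ x (λ p → proj₁ p * (proj₁ q * k (proj₂ p) (proj₂ q))))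
      ≡⟨ ∑-cong y (λ q → trans (∑-cong x (λ p → ℚ*.x∙yz≈y∙xz (proj₁ p) (proj₁ q) _)) (∑-* (proj₁ q) x _)) ⟩
    ∑ y (λ q → proj₁ q * ∑ x (λ p → proj₁ p * k (proj₂ p) (proj₂ q))) ∎
    where open ≡-Reasoning

  ⟪⟫-+ℋ : ∀ f x y → ⟪ f ⟫ (x +ℋ y) ≡ ⟪ f ⟫ x + ⟪ f ⟫ y
  ⟪⟫-+ℋ f x y = ∑-++ x y _

  ⟪⟫-· : ∀ f q x → ⟪ f ⟫ (q ·ℋ x) ≡ q * ⟪ f ⟫ x
  ⟪⟫-· f q x = trans (∑-map _ x _) (trans (∑-cong x (λ { (c , α) → ℚ.*-assoc q c (f α) })) (∑-* q x _))

  ⟪⟫-⟨⟩ : ∀ f x u → ⟪ f ⟫ ⟨ x , u ⟩ ≡ ⟪ f ▹ u ⟫ x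
  ⟪⟫-⟨⟩ f x u = trans (∑-map _ x _) (∑-cong x (λ { (c , α) → refl }))

  ⟪⟫-⟦⟧ : ∀ f α → ⟪ f ⟫ ⟦ α ⟧ ≡ f α
  ⟪⟫-⟦⟧ f α = trans (ℚ.+-identityʳ _) (ℚ.*-identityˡ (f α))

  ⟪⟫-⋆ : ∀ f x y → ⟪ f ⟫ (x ⋆ y) ≡ ⟪ (λ α → ⟪ (λ β → ⟪ f ⟫ (α ⋆ʷ β)) ⟫ y) ⟫ x
  ⟪⟫-⋆ f x y =
    trans (∑-concat (map _ x) _) (trans (∑-map _ x _) (∑-cong x λ { (c , α) →
      trans (∑-concat (map _ y) _) (trans (∑-map _ y _) (trans
        (∑-cong y λ { (d , β) → trans (⟪⟫-· f (c * d) (α ⋆ʷ β)) (ℚ.*-assoc c d _) })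
        (∑-* c y _))) }))

  ⟪⟫-sumℋ : ∀ f (g : I → ℋ) ks → ⟪ f ⟫ (sumℋ (map g ks)) ≡ ∑ ks (λ k → ⟪ f ⟫ (g k))
  ⟪⟫-sumℋ f g ks = trans (∑-concat (map g ks) _) (∑-map g ks _)

  coeff-⟪δ⟫ : ∀ x α → coeff x α ≡ ⟪ δ α ⟫ x
  coeff-⟪δ⟫ []            α = refl
  coeff-⟪δ⟫ ((c , β) ∷ x) α with β ≟W α
  ... | yes _ = cong₂ _+_ (sym (ℚ.*-identityʳ c)) (coeff-⟪δ⟫ x α)
  ... | no  _ = trans (coeff-⟪δ⟫ x α) (sym (trans (cong (_+ _) (ℚ.*-zeroʳ c)) (ℚ.+-identityˡ _)))

infix 4 _≃_
-- A record, not a function type, so that both sides can be inferred from a proof.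
record _≃_ (x y : ℋ) : Set where
  constructor by-forms
  field agree : ∀ f → ⟪ f ⟫ x ≡ ⟪ f ⟫ y
open _≃_ public

≃⇒≈ℋ : ∀ {x y} → x ≃ y → x ≈ℋ y
≃⇒≈ℋ {x} {y} x≃y α = trans (coeff-⟪δ⟫ x α) (trans (agree x≃y (δ α)) (sym (coeff-⟪δ⟫ y α)))

≡⇒≃ : ∀ {x y} → x ≡ y → x ≃ y
≡⇒≃ refl = by-forms λ f → refl

+ℋ-cong : ∀ {x x′ y y′} → x ≃ x′ → y ≃ y′ → x +ℋ y ≃ x′ +ℋ y′
+ℋ-cong {x} {x′} {y} {y′} x≃x′ y≃y′ = by-forms λ f →
  trans (⟪⟫-+ℋ f x y) (trans (cong₂ _+_ (agree x≃x′ f) (agree y≃y′ f)) (sym (⟪⟫-+ℋ f x′ y′)))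

+ℋ-isCommutativeMonoid : IsCommutativeMonoid _≃_ _+ℋ_ []
+ℋ-isCommutativeMonoid = record
  { isMonoid = record
    { isSemigroup = record
      { isMagma = record
        { isEquivalence = record
          { refl  = by-forms λ f → refl
          ; sym   = λ x≃y → by-forms λ f → sym (agree x≃y f)
          ; trans = λ x≃y y≃z → by-forms λ f → trans (agree x≃y f) (agree y≃z f)
          }
        ; ∙-cong = +ℋ-cong
        }
      ; assoc = λ x y z → ≡⇒≃ (List.++-assoc x y z)
      }
    ; identity = (λ x → by-forms λ f → refl) , (λ x → ≡⇒≃ (List.++-identityʳ x))
    }
  ; comm = λ x y → by-forms λ f →
      trans (⟪⟫-+ℋ f x y) (trans (ℚ.+-comm (⟪ f ⟫ x) (⟪ f ⟫ y)) (sym (⟪⟫-+ℋ f y x)))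
  }

+ℋ-commutativeMonoid : CommutativeMonoid 0ℓ 0ℓ
+ℋ-commutativeMonoid = record { isCommutativeMonoid = +ℋ-isCommutativeMonoid }

open CommutativeMonoid +ℋ-commutativeMonoid public
  using () renaming ( refl to ≃-refl; sym to ≃-sym; trans to ≃-trans; setoid to ≃-setoid
                    ; comm to +ℋ-comm; assoc to +ℋ-assoc; identityʳ to +ℋ-identityʳ)

+ℋ-congˡ : ∀ x {y z} → y ≃ z → x +ℋ y ≃ x +ℋ z
+ℋ-congˡ x = +ℋ-cong (≃-refl {x})

+ℋ-congʳ : ∀ x {y z} → y ≃ z → y +ℋ x ≃ z +ℋ x
+ℋ-congʳ x y≃z = +ℋ-cong y≃z (≃-refl {x})

module ≃-Reasoning = Relation.Binary.Reasoning.Setoid ≃-setoid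
open import Algebra.Solver.CommutativeMonoid +ℋ-commutativeMonoid using (solve; _⊜_) renaming (_⊕_ to _⊞_)

sumℋ-cong : ∀ {g h : I → ℋ} ks → (∀ k → g k ≃ h k) → sumℋ (map g ks) ≃ sumℋ (map h ks)
sumℋ-cong {g = g} {h} ks g≃h = by-forms λ f →
  trans (⟪⟫-sumℋ f g ks) (trans (∑-cong ks (λ k → agree (g≃h k) f)) (sym (⟪⟫-sumℋ f h ks)))

sumℋ-++ : ∀ (g : I → ℋ) ks ls → sumℋ (map g (ks ++ ls)) ≡ sumℋ (map g ks) +ℋ sumℋ (map g ls)
sumℋ-++ g ks ls = trans (cong concat (List.map-++ g ks ls)) (sym (List.concat-++ (map g ks) (map g ls)))

sumℋ-map : ∀ (g : I → ℋ) (h : J → I) ks → sumℋ (map g (map h ks)) ≡ sumℋ (map (g ∘ h) ks)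
sumℋ-map g h ks = cong concat (sym (List.map-∘ ks))

sumℋ-+ℋ : ∀ (g h : I → ℋ) ks → sumℋ (map (λ k → g k +ℋ h k) ks) ≃ sumℋ (map g ks) +ℋ sumℋ (map h ks)
sumℋ-+ℋ g h ks = by-forms λ f → begin
  ⟪ f ⟫ (sumℋ (map (λ k → g k +ℋ h k) ks))          ≡⟨ ⟪⟫-sumℋ f _ ks ⟩
  ∑ ks (λ k → ⟪ f ⟫ (g k +ℋ h k))                    ≡⟨ ∑-cong ks (λ k → ⟪⟫-+ℋ f (g k) (h k)) ⟩
  ∑ ks (λ k → ⟪ f ⟫ (g k) + ⟪ f ⟫ (h k))             ≡⟨ ∑-+ ks _ _ ⟩
  ∑ ks (λ k → ⟪ f ⟫ (g k)) + ∑ ks (λ k → ⟪ f ⟫ (h k)) ≡⟨ cong₂ _+_ (⟪⟫-sumℋ f g ks) (⟪⟫-sumℋ f h ks) ⟨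
  ⟪ f ⟫ (sumℋ (map g ks)) + ⟪ f ⟫ (sumℋ (map h ks))   ≡⟨ ⟪⟫-+ℋ f _ _ ⟨
  ⟪ f ⟫ (sumℋ (map g ks) +ℋ sumℋ (map h ks))          ∎
  where open ≡-Reasoning

⟨⟩-cong : ∀ {x y} u → x ≃ y → ⟨ x , u ⟩ ≃ ⟨ y , u ⟩
⟨⟩-cong {x} {y} u x≃y = by-forms λ f →
  trans (⟪⟫-⟨⟩ f x u) (trans (agree x≃y (f ▹ u)) (sym (⟪⟫-⟨⟩ f y u)))

⟨⟩-+ℋ : ∀ x y u → ⟨ x +ℋ y , u ⟩ ≡ ⟨ x , u ⟩ +ℋ ⟨ y , u ⟩
⟨⟩-+ℋ x y u = List.map-++ _ x y

⟨⟩-sumℋ : ∀ (g : I → ℋ) ks u → ⟨ sumℋ (map g ks) , u ⟩ ≃ sumℋ (map (λ k → ⟨ g k , u ⟩) ks)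
⟨⟩-sumℋ g ks u = by-forms λ f →
  trans (⟪⟫-⟨⟩ f _ u) (trans (⟪⟫-sumℋ (f ▹ u) g ks)
    (trans (∑-cong ks (λ k → sym (⟪⟫-⟨⟩ f (g k) u))) (sym (⟪⟫-sumℋ f _ ks))))

·ℋ-cong : ∀ {x y} q → x ≃ y → q ·ℋ x ≃ q ·ℋ y
·ℋ-cong {x} {y} q x≃y = by-forms λ f →
  trans (⟪⟫-· f q x) (trans (cong (q *_) (agree x≃y f)) (sym (⟪⟫-· f q y)))

·ℋ-+ℋ : ∀ q x y → q ·ℋ (x +ℋ y) ≡ q ·ℋ x +ℋ q ·ℋ y
·ℋ-+ℋ q x y = List.map-++ _ x y

·ℋ-identityˡ : ∀ x → 1ℚ ·ℋ x ≃ x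
·ℋ-identityˡ x = by-forms λ f → trans (⟪⟫-· f 1ℚ x) (ℚ.*-identityˡ (⟪ f ⟫ x))

sumℋ-negate : ∀ (s : I → ℚ) (g : I → ℋ) ks →
  sumℋ (map (λ k → (- s k) ·ℋ g k) ks) ≃ (- 1ℚ) ·ℋ sumℋ (map (λ k → s k ·ℋ g k) ks)
sumℋ-negate s g ks = by-forms λ f → begin
  ⟪ f ⟫ (sumℋ (map (λ k → (- s k) ·ℋ g k) ks))
    ≡⟨ trans (⟪⟫-sumℋ f _ ks) (∑-cong ks (λ k → ⟪⟫-· f (- s k) (g k))) ⟩
  ∑ ks (λ k → (- s k) * ⟪ f ⟫ (g k))
    ≡⟨ ∑-cong ks (λ k → trans (sym (ℚ.*-assoc (- 1ℚ) (s k) _)) (cong (_* ⟪ f ⟫ (g k)) (-1*q≡-q (s k)))) ⟨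
  ∑ ks (λ k → (- 1ℚ) * (s k * ⟪ f ⟫ (g k)))
    ≡⟨ ∑-* (- 1ℚ) ks _ ⟩
  (- 1ℚ) * ∑ ks (λ k → s k * ⟪ f ⟫ (g k))
    ≡⟨ trans (⟪⟫-· f (- 1ℚ) _) (cong ((- 1ℚ) *_)
         (trans (⟪⟫-sumℋ f _ ks) (∑-cong ks (λ k → ⟪⟫-· f (s k) (g k))))) ⟨
  ⟪ f ⟫ ((- 1ℚ) ·ℋ sumℋ (map (λ k → s k ·ℋ g k) ks)) ∎
  where open ≡-Reasoning

infixl 6 _−ℋ_
_−ℋ_ : ℋ → ℋ → ℋ
x −ℋ y = x +ℋ (- 1ℚ) ·ℋ y

⟪⟫-−ℋ : ∀ f x y → ⟪ f ⟫ (x −ℋ y) ≡ ⟪ f ⟫ x + (- 1ℚ) * ⟪ f ⟫ y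
⟪⟫-−ℋ f x y = trans (⟪⟫-+ℋ f x _) (cong (⟪ f ⟫ x +_) (⟪⟫-· f (- 1ℚ) y))

−ℋ-cong : ∀ {x x′ y y′} → x ≃ x′ → y ≃ y′ → x −ℋ y ≃ x′ −ℋ y′
−ℋ-cong x≃x′ y≃y′ = +ℋ-cong x≃x′ (·ℋ-cong (- 1ℚ) y≃y′)

+ℋ-−ℋ-cancel : ∀ x y → (x +ℋ y) −ℋ y ≃ x
+ℋ-−ℋ-cancel x y = by-forms λ f → begin
  ⟪ f ⟫ ((x +ℋ y) −ℋ y)                      ≡⟨ trans (⟪⟫-−ℋ f (x +ℋ y) y) (cong (_+ _) (⟪⟫-+ℋ f x y)) ⟩
  ⟪ f ⟫ x + ⟪ f ⟫ y + (- 1ℚ) * ⟪ f ⟫ y       ≡⟨ ℚ.+-assoc (⟪ f ⟫ x) _ _ ⟩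
  ⟪ f ⟫ x + (⟪ f ⟫ y + (- 1ℚ) * ⟪ f ⟫ y)     ≡⟨ cong (λ z → ⟪ f ⟫ x + (⟪ f ⟫ y + z)) (-1*q≡-q (⟪ f ⟫ y)) ⟩
  ⟪ f ⟫ x + (⟪ f ⟫ y + - ⟪ f ⟫ y)           ≡⟨ cong (⟪ f ⟫ x +_) (ℚ.+-inverseʳ (⟪ f ⟫ y)) ⟩
  ⟪ f ⟫ x + 0ℚ                              ≡⟨ ℚ.+-identityʳ _ ⟩
  ⟪ f ⟫ x                                   ∎
  where open ≡-Reasoning

⟨⟩-−ℋ : ∀ x y u → ⟨ x −ℋ y , u ⟩ ≃ ⟨ x , u ⟩ −ℋ ⟨ y , u ⟩
⟨⟩-−ℋ x y u = by-forms λ f →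
  trans (⟪⟫-⟨⟩ f _ u) (trans (⟪⟫-−ℋ (f ▹ u) x y)
    (sym (trans (⟪⟫-−ℋ f _ _) (cong₂ (λ a b → a + (- 1ℚ) * b) (⟪⟫-⟨⟩ f x u) (⟪⟫-⟨⟩ f y u)))))

−ℋ-+ℋ₃ : ∀ x₁ x₂ x₃ y₁ y₂ y₃ →
  (x₁ +ℋ x₂ +ℋ x₃) −ℋ (y₁ +ℋ y₂ +ℋ y₃) ≃ (x₁ −ℋ y₁) +ℋ (x₂ −ℋ y₂) +ℋ (x₃ −ℋ y₃)
−ℋ-+ℋ₃ x₁ x₂ x₃ y₁ y₂ y₃ = begin
  (x₁ +ℋ x₂ +ℋ x₃) +ℋ (- 1ℚ) ·ℋ (y₁ +ℋ y₂ +ℋ y₃)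
    ≡⟨ cong ((x₁ +ℋ x₂ +ℋ x₃) +ℋ_)
         (trans (·ℋ-+ℋ (- 1ℚ) (y₁ +ℋ y₂) y₃) (cong (_+ℋ n₃) (·ℋ-+ℋ (- 1ℚ) y₁ y₂))) ⟩
  (x₁ +ℋ x₂ +ℋ x₃) +ℋ (n₁ +ℋ n₂ +ℋ n₃)
    ≈⟨ solve 6 (λ x₁ x₂ x₃ n₁ n₂ n₃ →
         ((x₁ ⊞ x₂) ⊞ x₃) ⊞ ((n₁ ⊞ n₂) ⊞ n₃) ⊜ ((x₁ ⊞ n₁) ⊞ (x₂ ⊞ n₂)) ⊞ (x₃ ⊞ n₃))
         ≃-refl x₁ x₂ x₃ n₁ n₂ n₃ ⟩
  (x₁ +ℋ n₁) +ℋ (x₂ +ℋ n₂) +ℋ (x₃ +ℋ n₃) ∎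
  where
  open ≃-Reasoning
  n₁ = (- 1ℚ) ·ℋ y₁ ; n₂ = (- 1ℚ) ·ℋ y₂ ; n₃ = (- 1ℚ) ·ℋ y₃

−ℋ-+ℋ₃ˡ : ∀ x₁ x₂ x₃ y → (x₁ +ℋ x₂ +ℋ x₃) −ℋ y ≃ (x₁ −ℋ y) +ℋ x₂ +ℋ x₃
−ℋ-+ℋ₃ˡ x₁ x₂ x₃ y = solve 4 (λ x₁ x₂ x₃ n → ((x₁ ⊞ x₂) ⊞ x₃) ⊞ n ⊜ ((x₁ ⊞ n) ⊞ x₂) ⊞ x₃)
                       ≃-refl x₁ x₂ x₃ ((- 1ℚ) ·ℋ y)

⟪⟫-⋆ʳ : ∀ f x y → ⟪ f ⟫ (x ⋆ y) ≡ ⟪ (λ β → ⟪ (λ α → ⟪ f ⟫ (α ⋆ʷ β)) ⟫ x) ⟫ y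
⟪⟫-⋆ʳ f x y = trans (⟪⟫-⋆ f x y) (⟪⟫-swap (λ α β → ⟪ f ⟫ (α ⋆ʷ β)) x y)

⋆-cong : ∀ {x x′ y y′} → x ≃ x′ → y ≃ y′ → x ⋆ y ≃ x′ ⋆ y′
⋆-cong {x} {x′} {y} {y′} x≃x′ y≃y′ = by-forms λ f → begin
  ⟪ f ⟫ (x ⋆ y)                                        ≡⟨ ⟪⟫-⋆ f x y ⟩
  ⟪ (λ α → ⟪ (λ β → ⟪ f ⟫ (α ⋆ʷ β)) ⟫ y) ⟫ x           ≡⟨ ⟪⟫-cong x (λ α → agree y≃y′ _) ⟩
  ⟪ (λ α → ⟪ (λ β → ⟪ f ⟫ (α ⋆ʷ β)) ⟫ y′) ⟫ x          ≡⟨ agree x≃x′ _ ⟩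
  ⟪ (λ α → ⟪ (λ β → ⟪ f ⟫ (α ⋆ʷ β)) ⟫ y′) ⟫ x′         ≡⟨ ⟪⟫-⋆ f x′ y′ ⟨
  ⟪ f ⟫ (x′ ⋆ y′)                                      ∎
  where open ≡-Reasoning

⋆-distribʳ : ∀ x y z → (x +ℋ y) ⋆ z ≃ x ⋆ z +ℋ y ⋆ z
⋆-distribʳ x y z = by-forms λ f →
  trans (⟪⟫-⋆ f (x +ℋ y) z) (trans (⟪⟫-+ℋ _ x y)
    (sym (trans (⟪⟫-+ℋ f (x ⋆ z) (y ⋆ z)) (cong₂ _+_ (⟪⟫-⋆ f x z) (⟪⟫-⋆ f y z)))))

⋆-distribˡ : ∀ x y z → x ⋆ (y +ℋ z) ≃ x ⋆ y +ℋ x ⋆ z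
⋆-distribˡ x y z = by-forms λ f →
  trans (⟪⟫-⋆ʳ f x (y +ℋ z)) (trans (⟪⟫-+ℋ _ y z)
    (sym (trans (⟪⟫-+ℋ f (x ⋆ y) (x ⋆ z)) (cong₂ _+_ (⟪⟫-⋆ʳ f x y) (⟪⟫-⋆ʳ f x z)))))

⋆-−ℋ : ∀ x y z → x ⋆ (y −ℋ z) ≃ x ⋆ y −ℋ x ⋆ z
⋆-−ℋ x y z = by-forms λ f →
  trans (⟪⟫-⋆ʳ f x (y −ℋ z)) (trans (⟪⟫-−ℋ _ y z)
    (sym (trans (⟪⟫-−ℋ f (x ⋆ y) (x ⋆ z)) (cong₂ (λ a b → a + (- 1ℚ) * b) (⟪⟫-⋆ʳ f x y) (⟪⟫-⋆ʳ f x z)))))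

⋆-sumℋ : ∀ x (g : I → ℋ) ks → x ⋆ sumℋ (map g ks) ≃ sumℋ (map (λ k → x ⋆ g k) ks)
⋆-sumℋ x g ks = by-forms λ f →
  trans (⟪⟫-⋆ʳ f x _) (trans (⟪⟫-sumℋ _ g ks)
    (sym (trans (⟪⟫-sumℋ f _ ks) (∑-cong ks (λ k → ⟪⟫-⋆ʳ f x (g k))))))

sumℋ-⋆ : ∀ (g : I → ℋ) ks y → sumℋ (map g ks) ⋆ y ≃ sumℋ (map (λ k → g k ⋆ y) ks)
sumℋ-⋆ g ks y = by-forms λ f →
  trans (⟪⟫-⋆ f _ y) (trans (⟪⟫-sumℋ _ g ks)
    (sym (trans (⟪⟫-sumℋ f _ ks) (∑-cong ks (λ k → ⟪⟫-⋆ f (g k) y)))))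

ε-⋆ʷ : ∀ α → ε ⋆ʷ α ≡ ⟦ α ⟧
ε-⋆ʷ ε       = refl
ε-⋆ʷ (α ,, u) = refl

⋆-⟦ε⟧ : ∀ x → x ⋆ ⟦ ε ⟧ ≃ x
⋆-⟦ε⟧ x = by-forms λ f →
  trans (⟪⟫-⋆ f x ⟦ ε ⟧) (⟪⟫-cong x (λ α → trans (⟪⟫-⟦⟧ _ ε) (⟪⟫-⟦⟧ f α)))

⟦ε⟧-⋆ : ∀ x → ⟦ ε ⟧ ⋆ x ≃ x
⟦ε⟧-⋆ x = by-forms λ f →
  trans (⟪⟫-⋆ʳ f ⟦ ε ⟧ x) (⟪⟫-cong x (λ β → trans (⟪⟫-⟦⟧ _ ε) (trans (cong ⟪ f ⟫ (ε-⋆ʷ β)) (⟪⟫-⟦⟧ f β))))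

⟦⟧-⋆-⟦⟧ : ∀ α β → ⟦ α ⟧ ⋆ ⟦ β ⟧ ≃ α ⋆ʷ β
⟦⟧-⋆-⟦⟧ α β = by-forms λ f → trans (⟪⟫-⋆ f ⟦ α ⟧ ⟦ β ⟧) (trans (⟪⟫-⟦⟧ _ α) (⟪⟫-⟦⟧ _ β))

⟪⟫-+ℋ₃ : ∀ f x y z → ⟪ f ⟫ (x +ℋ y +ℋ z) ≡ ⟪ f ⟫ x + ⟪ f ⟫ y + ⟪ f ⟫ z
⟪⟫-+ℋ₃ f x y z = trans (⟪⟫-+ℋ f (x +ℋ y) z) (cong (_+ ⟪ f ⟫ z) (⟪⟫-+ℋ f x y))

⟪⟫²-+₃ : ∀ (P Q R : Word → Word → ℚ) x y →
  ⟪ (λ α → ⟪ (λ β → P α β + Q α β + R α β) ⟫ y) ⟫ x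
    ≡ ⟪ (λ α → ⟪ P α ⟫ y) ⟫ x + ⟪ (λ α → ⟪ Q α ⟫ y) ⟫ x + ⟪ (λ α → ⟪ R α ⟫ y) ⟫ x
⟪⟫²-+₃ P Q R x y = begin
  ⟪ (λ α → ⟪ (λ β → P α β + Q α β + R α β) ⟫ y) ⟫ x
    ≡⟨ ⟪⟫-cong x (λ α → trans (⟪⟫-+ _ (R α) y) (cong (_+ _) (⟪⟫-+ (P α) (Q α) y))) ⟩
  ⟪ (λ α → ⟪ P α ⟫ y + ⟪ Q α ⟫ y + ⟪ R α ⟫ y) ⟫ x
    ≡⟨ trans (⟪⟫-+ _ _ x) (cong (_+ _) (⟪⟫-+ _ _ x)) ⟩
  ⟪ (λ α → ⟪ P α ⟫ y) ⟫ x + ⟪ (λ α → ⟪ Q α ⟫ y) ⟫ x + ⟪ (λ α → ⟪ R α ⟫ y) ⟫ x ∎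
  where open ≡-Reasoning

⟨⟩-⋆-⟨⟩ : ∀ x a y b →
  ⟨ x , a ⟩ ⋆ ⟨ y , b ⟩ ≃ ⟨ x ⋆ ⟨ y , b ⟩ , a ⟩ +ℋ ⟨ ⟨ x , a ⟩ ⋆ y , b ⟩ +ℋ ⟨ x ⋆ y , a ⊕ b ⟩
⟨⟩-⋆-⟨⟩ x a y b = by-forms λ f → begin
  ⟪ f ⟫ (⟨ x , a ⟩ ⋆ ⟨ y , b ⟩)
    ≡⟨ trans (⟪⟫-⋆ f _ _) (trans (⟪⟫-⟨⟩ _ x a) (⟪⟫-cong x (λ α → ⟪⟫-⟨⟩ _ y b))) ⟩
  ⟪ (λ α → ⟪ (λ β → ⟪ f ⟫ ((α ,, a) ⋆ʷ (β ,, b))) ⟫ y) ⟫ x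
    ≡⟨ ⟪⟫-cong x (λ α → ⟪⟫-cong y (λ β → expand f α β)) ⟩
  ⟪ (λ α → ⟪ (λ β → ⟪ f ▹ a ⟫ (α ⋆ʷ (β ,, b)) + ⟪ f ▹ b ⟫ ((α ,, a) ⋆ʷ β)
                     + ⟪ f ▹ (a ⊕ b) ⟫ (α ⋆ʷ β)) ⟫ y) ⟫ x
    ≡⟨ ⟪⟫²-+₃ _ _ _ x y ⟩
  ⟪ (λ α → ⟪ (λ β → ⟪ f ▹ a ⟫ (α ⋆ʷ (β ,, b))) ⟫ y) ⟫ x
    + ⟪ (λ α → ⟪ (λ β → ⟪ f ▹ b ⟫ ((α ,, a) ⋆ʷ β)) ⟫ y) ⟫ x
    + ⟪ (λ α → ⟪ (λ β → ⟪ f ▹ (a ⊕ b) ⟫ (α ⋆ʷ β)) ⟫ y) ⟫ x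
    ≡⟨ cong₂ _+_ (cong₂ _+_
         (trans (⟪⟫-⟨⟩ f _ a) (trans (⟪⟫-⋆ _ x _) (⟪⟫-cong x (λ α → ⟪⟫-⟨⟩ _ y b))))
         (trans (⟪⟫-⟨⟩ f _ b) (trans (⟪⟫-⋆ _ _ y) (⟪⟫-⟨⟩ _ x a))))
         (trans (⟪⟫-⟨⟩ f _ (a ⊕ b)) (⟪⟫-⋆ _ x y)) ⟨
  ⟪ f ⟫ ⟨ x ⋆ ⟨ y , b ⟩ , a ⟩ + ⟪ f ⟫ ⟨ ⟨ x , a ⟩ ⋆ y , b ⟩ + ⟪ f ⟫ ⟨ x ⋆ y , a ⊕ b ⟩
    ≡⟨ ⟪⟫-+ℋ₃ f _ _ _ ⟨
  ⟪ f ⟫ (⟨ x ⋆ ⟨ y , b ⟩ , a ⟩ +ℋ ⟨ ⟨ x , a ⟩ ⋆ y , b ⟩ +ℋ ⟨ x ⋆ y , a ⊕ b ⟩) ∎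
  where
  open ≡-Reasoning
  expand : ∀ f α β → ⟪ f ⟫ ((α ,, a) ⋆ʷ (β ,, b))
    ≡ ⟪ f ▹ a ⟫ (α ⋆ʷ (β ,, b)) + ⟪ f ▹ b ⟫ ((α ,, a) ⋆ʷ β) + ⟪ f ▹ (a ⊕ b) ⟫ (α ⋆ʷ β)
  expand f α β = trans (⟪⟫-+ℋ₃ f _ _ _)
    (cong₂ _+_ (cong₂ _+_ (⟪⟫-⟨⟩ f _ a) (⟪⟫-⟨⟩ f _ b)) (⟪⟫-⟨⟩ f _ (a ⊕ b)))

+ℋ-transpose : ∀ x₁ y₁ z₁ x₂ y₂ z₂ x₃ y₃ z₃ →
  (x₁ +ℋ y₁ +ℋ z₁) +ℋ (x₂ +ℋ y₂ +ℋ z₂) +ℋ (x₃ +ℋ y₃ +ℋ z₃)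
    ≃ (x₁ +ℋ x₂ +ℋ x₃) +ℋ (y₁ +ℋ y₂ +ℋ y₃) +ℋ (z₁ +ℋ z₂ +ℋ z₃)
+ℋ-transpose = solve 9 (λ x₁ y₁ z₁ x₂ y₂ z₂ x₃ y₃ z₃ →
  (((x₁ ⊞ y₁) ⊞ z₁) ⊞ ((x₂ ⊞ y₂) ⊞ z₂)) ⊞ ((x₃ ⊞ y₃) ⊞ z₃)
    ⊜ (((x₁ ⊞ x₂) ⊞ x₃) ⊞ ((y₁ ⊞ y₂) ⊞ y₃)) ⊞ ((z₁ ⊞ z₂) ⊞ z₃)) ≃-refl

⟨⟩-+ℋ₃ : ∀ x y z u → ⟨ x +ℋ y +ℋ z , u ⟩ ≡ ⟨ x , u ⟩ +ℋ ⟨ y , u ⟩ +ℋ ⟨ z , u ⟩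
⟨⟩-+ℋ₃ x y z u = trans (⟨⟩-+ℋ (x +ℋ y) z u) (cong (_+ℋ ⟨ z , u ⟩) (⟨⟩-+ℋ x y u))

⋆-distribʳ₃ : ∀ x y z w → (x +ℋ y +ℋ z) ⋆ w ≃ x ⋆ w +ℋ y ⋆ w +ℋ z ⋆ w
⋆-distribʳ₃ x y z w = ≃-trans (⋆-distribʳ (x +ℋ y) z w) (+ℋ-congʳ (z ⋆ w) (⋆-distribʳ x y w))

⋆-distribˡ₃ : ∀ w x y z → w ⋆ (x +ℋ y +ℋ z) ≃ w ⋆ x +ℋ w ⋆ y +ℋ w ⋆ z
⋆-distribˡ₃ w x y z = ≃-trans (⋆-distribˡ w (x +ℋ y) z) (+ℋ-congʳ (w ⋆ z) (⋆-distribˡ w x y))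

⟨⟩₃-⋆-⟨⟩ : ∀ x₁ a₁ x₂ a₂ x₃ a₃ z c →
  let X = ⟨ x₁ , a₁ ⟩ +ℋ ⟨ x₂ , a₂ ⟩ +ℋ ⟨ x₃ , a₃ ⟩ ; Z = ⟨ z , c ⟩ in
  X ⋆ Z ≃ (⟨ x₁ ⋆ Z , a₁ ⟩ +ℋ ⟨ x₂ ⋆ Z , a₂ ⟩ +ℋ ⟨ x₃ ⋆ Z , a₃ ⟩)
          +ℋ ⟨ X ⋆ z , c ⟩
          +ℋ (⟨ x₁ ⋆ z , a₁ ⊕ c ⟩ +ℋ ⟨ x₂ ⋆ z , a₂ ⊕ c ⟩ +ℋ ⟨ x₃ ⋆ z , a₃ ⊕ c ⟩)
⟨⟩₃-⋆-⟨⟩ x₁ a₁ x₂ a₂ x₃ a₃ z c = begin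
  (X₁ +ℋ X₂ +ℋ X₃) ⋆ Z
    ≈⟨ ⋆-distribʳ₃ X₁ X₂ X₃ Z ⟩
  X₁ ⋆ Z +ℋ X₂ ⋆ Z +ℋ X₃ ⋆ Z
    ≈⟨ +ℋ-cong (+ℋ-cong (⟨⟩-⋆-⟨⟩ x₁ a₁ z c) (⟨⟩-⋆-⟨⟩ x₂ a₂ z c)) (⟨⟩-⋆-⟨⟩ x₃ a₃ z c) ⟩
  (p₁ +ℋ q₁ +ℋ r₁) +ℋ (p₂ +ℋ q₂ +ℋ r₂) +ℋ (p₃ +ℋ q₃ +ℋ r₃)
    ≈⟨ +ℋ-transpose p₁ q₁ r₁ p₂ q₂ r₂ p₃ q₃ r₃ ⟩
  (p₁ +ℋ p₂ +ℋ p₃) +ℋ (q₁ +ℋ q₂ +ℋ q₃) +ℋ (r₁ +ℋ r₂ +ℋ r₃)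
    ≈⟨ +ℋ-congʳ (r₁ +ℋ r₂ +ℋ r₃) (+ℋ-congˡ (p₁ +ℋ p₂ +ℋ p₃)
         (≃-trans (≡⇒≃ (sym (⟨⟩-+ℋ₃ (X₁ ⋆ z) (X₂ ⋆ z) (X₃ ⋆ z) c)))
                  (⟨⟩-cong c (≃-sym (⋆-distribʳ₃ X₁ X₂ X₃ z))))) ⟩
  (p₁ +ℋ p₂ +ℋ p₃) +ℋ ⟨ (X₁ +ℋ X₂ +ℋ X₃) ⋆ z , c ⟩ +ℋ (r₁ +ℋ r₂ +ℋ r₃) ∎
  where
  open ≃-Reasoning
  X₁ = ⟨ x₁ , a₁ ⟩ ; X₂ = ⟨ x₂ , a₂ ⟩ ; X₃ = ⟨ x₃ , a₃ ⟩ ; Z = ⟨ z , c ⟩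
  p₁ = ⟨ x₁ ⋆ Z , a₁ ⟩ ; p₂ = ⟨ x₂ ⋆ Z , a₂ ⟩ ; p₃ = ⟨ x₃ ⋆ Z , a₃ ⟩
  q₁ = ⟨ X₁ ⋆ z , c ⟩ ; q₂ = ⟨ X₂ ⋆ z , c ⟩ ; q₃ = ⟨ X₃ ⋆ z , c ⟩
  r₁ = ⟨ x₁ ⋆ z , a₁ ⊕ c ⟩ ; r₂ = ⟨ x₂ ⋆ z , a₂ ⊕ c ⟩ ; r₃ = ⟨ x₃ ⋆ z , a₃ ⊕ c ⟩

⟨⟩-⋆-⟨⟩₃ : ∀ x a y₁ b₁ y₂ b₂ y₃ b₃ →
  let X = ⟨ x , a ⟩ ; Y = ⟨ y₁ , b₁ ⟩ +ℋ ⟨ y₂ , b₂ ⟩ +ℋ ⟨ y₃ , b₃ ⟩ in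
  X ⋆ Y ≃ ⟨ x ⋆ Y , a ⟩
          +ℋ (⟨ X ⋆ y₁ , b₁ ⟩ +ℋ ⟨ X ⋆ y₂ , b₂ ⟩ +ℋ ⟨ X ⋆ y₃ , b₃ ⟩)
          +ℋ (⟨ x ⋆ y₁ , a ⊕ b₁ ⟩ +ℋ ⟨ x ⋆ y₂ , a ⊕ b₂ ⟩ +ℋ ⟨ x ⋆ y₃ , a ⊕ b₃ ⟩)
⟨⟩-⋆-⟨⟩₃ x a y₁ b₁ y₂ b₂ y₃ b₃ = begin
  X ⋆ (Y₁ +ℋ Y₂ +ℋ Y₃)
    ≈⟨ ⋆-distribˡ₃ X Y₁ Y₂ Y₃ ⟩
  X ⋆ Y₁ +ℋ X ⋆ Y₂ +ℋ X ⋆ Y₃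
    ≈⟨ +ℋ-cong (+ℋ-cong (⟨⟩-⋆-⟨⟩ x a y₁ b₁) (⟨⟩-⋆-⟨⟩ x a y₂ b₂)) (⟨⟩-⋆-⟨⟩ x a y₃ b₃) ⟩
  (p₁ +ℋ q₁ +ℋ r₁) +ℋ (p₂ +ℋ q₂ +ℋ r₂) +ℋ (p₃ +ℋ q₃ +ℋ r₃)
    ≈⟨ +ℋ-transpose p₁ q₁ r₁ p₂ q₂ r₂ p₃ q₃ r₃ ⟩
  (p₁ +ℋ p₂ +ℋ p₃) +ℋ (q₁ +ℋ q₂ +ℋ q₃) +ℋ (r₁ +ℋ r₂ +ℋ r₃)
    ≈⟨ +ℋ-congʳ (r₁ +ℋ r₂ +ℋ r₃) (+ℋ-congʳ (q₁ +ℋ q₂ +ℋ q₃)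
         (≃-trans (≡⇒≃ (sym (⟨⟩-+ℋ₃ (x ⋆ Y₁) (x ⋆ Y₂) (x ⋆ Y₃) a)))
                  (⟨⟩-cong a (≃-sym (⋆-distribˡ₃ x Y₁ Y₂ Y₃))))) ⟩
  ⟨ x ⋆ (Y₁ +ℋ Y₂ +ℋ Y₃) , a ⟩ +ℋ (q₁ +ℋ q₂ +ℋ q₃) +ℋ (r₁ +ℋ r₂ +ℋ r₃) ∎
  where
  open ≃-Reasoning
  X = ⟨ x , a ⟩ ; Y₁ = ⟨ y₁ , b₁ ⟩ ; Y₂ = ⟨ y₂ , b₂ ⟩ ; Y₃ = ⟨ y₃ , b₃ ⟩
  p₁ = ⟨ x ⋆ Y₁ , a ⟩ ; p₂ = ⟨ x ⋆ Y₂ , a ⟩ ; p₃ = ⟨ x ⋆ Y₃ , a ⟩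
  q₁ = ⟨ X ⋆ y₁ , b₁ ⟩ ; q₂ = ⟨ X ⋆ y₂ , b₂ ⟩ ; q₃ = ⟨ X ⋆ y₃ , b₃ ⟩
  r₁ = ⟨ x ⋆ y₁ , a ⊕ b₁ ⟩ ; r₂ = ⟨ x ⋆ y₂ , a ⊕ b₂ ⟩ ; r₃ = ⟨ x ⋆ y₃ , a ⊕ b₃ ⟩

-- Associativity

⋆ʷ-assoc : ∀ α β γ → (α ⋆ʷ β) ⋆ ⟦ γ ⟧ ≃ ⟦ α ⟧ ⋆ (β ⋆ʷ γ)
⋆ʷ-assoc ε β γ = begin
  (ε ⋆ʷ β) ⋆ ⟦ γ ⟧ ≡⟨ cong (_⋆ ⟦ γ ⟧) (ε-⋆ʷ β) ⟩
  ⟦ β ⟧ ⋆ ⟦ γ ⟧    ≈⟨ ⟦⟧-⋆-⟦⟧ β γ ⟩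
  β ⋆ʷ γ           ≈⟨ ⟦ε⟧-⋆ (β ⋆ʷ γ) ⟨
  ⟦ ε ⟧ ⋆ (β ⋆ʷ γ) ∎
  where open ≃-Reasoning
⋆ʷ-assoc (α ,, a) ε        γ = ≡⇒≃ (cong (⟦ α ,, a ⟧ ⋆_) (sym (ε-⋆ʷ γ)))
⋆ʷ-assoc (α ,, a) (β ,, b) ε = ≃-trans (⋆-⟦ε⟧ _) (≃-sym (⟦⟧-⋆-⟦⟧ (α ,, a) (β ,, b)))
⋆ʷ-assoc (α ,, a) (β ,, b) (γ ,, c) = begin
  ((α ,, a) ⋆ʷ (β ,, b)) ⋆ ⟦ γ ,, c ⟧
    ≈⟨ ⟨⟩₃-⋆-⟨⟩ (α ⋆ʷ (β ,, b)) a ((α ,, a) ⋆ʷ β) b (α ⋆ʷ β) (a ⊕ b) ⟦ γ ⟧ c ⟩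
  (p₁ +ℋ p₂ +ℋ p₃) +ℋ p₄ +ℋ (p₅ +ℋ p₆ +ℋ p₇)
    ≈⟨ +ℋ-cong (+ℋ-cong (+ℋ-cong (+ℋ-cong
         (⟨⟩-cong a (⋆ʷ-assoc α (β ,, b) (γ ,, c)))
         (⟨⟩-cong b (⋆ʷ-assoc (α ,, a) β (γ ,, c))))
         (⟨⟩-cong (a ⊕ b) (⋆ʷ-assoc α β (γ ,, c))))
         (⟨⟩-cong c (⋆ʷ-assoc (α ,, a) (β ,, b) γ)))
         (+ℋ-cong (+ℋ-cong
         (⟨⟩-cong (a ⊕ c) (⋆ʷ-assoc α (β ,, b) γ))
         (⟨⟩-cong (b ⊕ c) (⋆ʷ-assoc (α ,, a) β γ)))
         (≃-trans (⟨⟩-cong ((a ⊕ b) ⊕ c) (⋆ʷ-assoc α β γ))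
                  (≡⇒≃ (cong (⟨ ⟦ α ⟧ ⋆ (β ⋆ʷ γ) ,_⟩) (⊕-assoc a b c))))) ⟩
  (q₁ +ℋ q₂ +ℋ q₃) +ℋ q₄ +ℋ (q₅ +ℋ q₆ +ℋ q₇)
    ≈⟨ solve 7 (λ q₁ q₂ q₃ q₄ q₅ q₆ q₇ →
         (((q₁ ⊞ q₂) ⊞ q₃) ⊞ q₄) ⊞ ((q₅ ⊞ q₆) ⊞ q₇)
           ⊜ (q₁ ⊞ ((q₂ ⊞ q₄) ⊞ q₆)) ⊞ ((q₃ ⊞ q₅) ⊞ q₇)) ≃-refl q₁ q₂ q₃ q₄ q₅ q₆ q₇ ⟩
  q₁ +ℋ (q₂ +ℋ q₄ +ℋ q₆) +ℋ (q₃ +ℋ q₅ +ℋ q₇)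
    ≈⟨ ⟨⟩-⋆-⟨⟩₃ ⟦ α ⟧ a (β ⋆ʷ (γ ,, c)) b ((β ,, b) ⋆ʷ γ) c (β ⋆ʷ γ) (b ⊕ c) ⟨
  ⟦ α ,, a ⟧ ⋆ ((β ,, b) ⋆ʷ (γ ,, c)) ∎
  where
  open ≃-Reasoning
  p₁ = ⟨ (α ⋆ʷ (β ,, b)) ⋆ ⟦ γ ,, c ⟧ , a ⟩
  p₂ = ⟨ ((α ,, a) ⋆ʷ β) ⋆ ⟦ γ ,, c ⟧ , b ⟩
  p₃ = ⟨ (α ⋆ʷ β) ⋆ ⟦ γ ,, c ⟧ , a ⊕ b ⟩
  p₄ = ⟨ ((α ,, a) ⋆ʷ (β ,, b)) ⋆ ⟦ γ ⟧ , c ⟩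
  p₅ = ⟨ (α ⋆ʷ (β ,, b)) ⋆ ⟦ γ ⟧ , a ⊕ c ⟩
  p₆ = ⟨ ((α ,, a) ⋆ʷ β) ⋆ ⟦ γ ⟧ , b ⊕ c ⟩
  p₇ = ⟨ (α ⋆ʷ β) ⋆ ⟦ γ ⟧ , (a ⊕ b) ⊕ c ⟩
  q₁ = ⟨ ⟦ α ⟧ ⋆ ((β ,, b) ⋆ʷ (γ ,, c)) , a ⟩
  q₂ = ⟨ ⟦ α ,, a ⟧ ⋆ (β ⋆ʷ (γ ,, c)) , b ⟩
  q₃ = ⟨ ⟦ α ⟧ ⋆ (β ⋆ʷ (γ ,, c)) , a ⊕ b ⟩
  q₄ = ⟨ ⟦ α ,, a ⟧ ⋆ ((β ,, b) ⋆ʷ γ) , c ⟩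
  q₅ = ⟨ ⟦ α ⟧ ⋆ ((β ,, b) ⋆ʷ γ) , a ⊕ c ⟩
  q₆ = ⟨ ⟦ α ,, a ⟧ ⋆ (β ⋆ʷ γ) , b ⊕ c ⟩
  q₇ = ⟨ ⟦ α ⟧ ⋆ (β ⋆ʷ γ) , a ⊕ (b ⊕ c) ⟩

⋆-assoc : ∀ x y z → (x ⋆ y) ⋆ z ≃ x ⋆ (y ⋆ z)
⋆-assoc x y z = by-forms λ f → begin
  ⟪ f ⟫ ((x ⋆ y) ⋆ z)
    ≡⟨ trans (⟪⟫-⋆ f (x ⋆ y) z) (⟪⟫-⋆ _ x y) ⟩
  ⟪ (λ α → ⟪ (λ β → ⟪ (λ δ → ⟪ (λ γ → ⟪ f ⟫ (δ ⋆ʷ γ)) ⟫ z) ⟫ (α ⋆ʷ β)) ⟫ y) ⟫ x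
    ≡⟨ ⟪⟫-cong x (λ α → ⟪⟫-cong y (λ β → trans (⟪⟫-swap _ (α ⋆ʷ β) z)
         (⟪⟫-cong z (λ γ → word-assoc α β γ f)))) ⟩
  ⟪ (λ α → ⟪ (λ β → ⟪ (λ γ → ⟪ (λ η → ⟪ f ⟫ (α ⋆ʷ η)) ⟫ (β ⋆ʷ γ)) ⟫ z) ⟫ y) ⟫ x
    ≡⟨ trans (⟪⟫-⋆ f x (y ⋆ z)) (⟪⟫-cong x (λ α → ⟪⟫-⋆ _ y z)) ⟨
  ⟪ f ⟫ (x ⋆ (y ⋆ z)) ∎
  where
  open ≡-Reasoning
  word-assoc : ∀ α β γ f → ⟪ (λ δ → ⟪ f ⟫ (δ ⋆ʷ γ)) ⟫ (α ⋆ʷ β) ≡ ⟪ (λ η → ⟪ f ⟫ (α ⋆ʷ η)) ⟫ (β ⋆ʷ γ)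
  word-assoc α β γ f = begin
    ⟪ (λ δ → ⟪ f ⟫ (δ ⋆ʷ γ)) ⟫ (α ⋆ʷ β)
      ≡⟨ trans (⟪⟫-⋆ f (α ⋆ʷ β) ⟦ γ ⟧) (⟪⟫-cong (α ⋆ʷ β) (λ δ → ⟪⟫-⟦⟧ _ γ)) ⟨
    ⟪ f ⟫ ((α ⋆ʷ β) ⋆ ⟦ γ ⟧)
      ≡⟨ agree (⋆ʷ-assoc α β γ) f ⟩
    ⟪ f ⟫ (⟦ α ⟧ ⋆ (β ⋆ʷ γ))
      ≡⟨ trans (⟪⟫-⋆ f ⟦ α ⟧ (β ⋆ʷ γ)) (⟪⟫-⟦⟧ _ α) ⟩
    ⟪ (λ η → ⟪ f ⟫ (α ⋆ʷ η)) ⟫ (β ⋆ʷ γ)   ∎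

-- The recursion on first letters

_◁_ : S → Word → Word
a ◁ ε        = ε ,, a
a ◁ (α ,, b) = (a ◁ α) ,, b

_◁ℋ_ : S → ℋ → ℋ
a ◁ℋ x = map (map₂ (a ◁_)) x

infixr 6 _◁_
infixr 7 _◁ℋ_

opaque
  unfolding ⟪_⟫

  ⟪⟫-◁ℋ : ∀ f a x → ⟪ f ⟫ (a ◁ℋ x) ≡ ⟪ f ∘ (a ◁_) ⟫ x
  ⟪⟫-◁ℋ f a x = ∑-map _ x _

◁ℋ-cong : ∀ {x y} a → x ≃ y → a ◁ℋ x ≃ a ◁ℋ y
◁ℋ-cong {x} {y} a x≃y = by-forms λ f →
  trans (⟪⟫-◁ℋ f a x) (trans (agree x≃y (f ∘ (a ◁_))) (sym (⟪⟫-◁ℋ f a y)))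

◁ℋ-⟨⟩ : ∀ a x c → a ◁ℋ ⟨ x , c ⟩ ≡ ⟨ a ◁ℋ x , c ⟩
◁ℋ-⟨⟩ a []            c = refl
◁ℋ-⟨⟩ a ((d , β) ∷ x) c = cong (_ ∷_) (◁ℋ-⟨⟩ a x c)

◁ℋ-⟨⟩₃ : ∀ a x c y d z e →
  a ◁ℋ (⟨ x , c ⟩ +ℋ ⟨ y , d ⟩ +ℋ ⟨ z , e ⟩) ≡ ⟨ a ◁ℋ x , c ⟩ +ℋ ⟨ a ◁ℋ y , d ⟩ +ℋ ⟨ a ◁ℋ z , e ⟩
◁ℋ-⟨⟩₃ a x c y d z e = begin
  a ◁ℋ (⟨ x , c ⟩ +ℋ ⟨ y , d ⟩ +ℋ ⟨ z , e ⟩)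
    ≡⟨ trans (List.map-++ _ (⟨ x , c ⟩ +ℋ ⟨ y , d ⟩) _)
             (cong (_+ℋ a ◁ℋ ⟨ z , e ⟩) (List.map-++ _ ⟨ x , c ⟩ _)) ⟩
  a ◁ℋ ⟨ x , c ⟩ +ℋ a ◁ℋ ⟨ y , d ⟩ +ℋ a ◁ℋ ⟨ z , e ⟩
    ≡⟨ cong₂ _+ℋ_ (cong₂ _+ℋ_ (◁ℋ-⟨⟩ a x c) (◁ℋ-⟨⟩ a y d)) (◁ℋ-⟨⟩ a z e) ⟩
  ⟨ a ◁ℋ x , c ⟩ +ℋ ⟨ a ◁ℋ y , d ⟩ +ℋ ⟨ a ◁ℋ z , e ⟩ ∎
  where open ≡-Reasoning

◁-++ʷ : ∀ a α vs → (a ◁ α) ++ʷ vs ≡ a ◁ (α ++ʷ vs)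
◁-++ʷ a α []       = refl
◁-++ʷ a α (v ∷ vs) = ◁-++ʷ a (α ,, v) vs

word-∷ : ∀ a vs → word (a ∷ vs) ≡ a ◁ word vs
word-∷ a vs = ◁-++ʷ a ε vs

++ʷ-∷ʳ : ∀ α vs v → α ++ʷ (vs ∷ʳ v) ≡ (α ++ʷ vs) ,, v
++ʷ-∷ʳ α []       v = refl
++ʷ-∷ʳ α (u ∷ vs) v = ++ʷ-∷ʳ (α ,, u) vs v

⟦word-∷ʳ⟧ : ∀ vs v → ⟦ word (vs ∷ʳ v) ⟧ ≡ ⟨ ⟦ word vs ⟧ , v ⟩
⟦word-∷ʳ⟧ vs v = cong ⟦_⟧ (++ʷ-∷ʳ ε vs v)

◁-⋆ʷ-◁ : ∀ a b p q →
  (a ◁ p) ⋆ʷ (b ◁ q) ≃ a ◁ℋ (p ⋆ʷ (b ◁ q)) +ℋ b ◁ℋ ((a ◁ p) ⋆ʷ q) +ℋ (a ⊕ b) ◁ℋ (p ⋆ʷ q)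
◁-⋆ʷ-◁ a b ε ε = +ℋ-congʳ ⟦ ε ,, a ⊕ b ⟧ (+ℋ-comm ⟦ ε ,, b ,, a ⟧ ⟦ ε ,, a ,, b ⟧)
◁-⋆ʷ-◁ a b (p ,, c) ε = begin
  ⟨ (a ◁ p) ⋆ʷ (b ◁ ε) , c ⟩ +ℋ X +ℋ Y
    ≈⟨ +ℋ-congʳ Y (+ℋ-congʳ X (⟨⟩-cong c (◁-⋆ʷ-◁ a b p ε))) ⟩
  ⟨ a ◁ℋ (p ⋆ʷ (b ◁ ε)) +ℋ ⟦ b ◁ a ◁ p ⟧ +ℋ ⟦ (a ⊕ b) ◁ p ⟧ , c ⟩ +ℋ X +ℋ Y
    ≡⟨ cong (λ z → z +ℋ X +ℋ Y) (⟨⟩-+ℋ₃ (a ◁ℋ (p ⋆ʷ (b ◁ ε))) ⟦ b ◁ a ◁ p ⟧ ⟦ (a ⊕ b) ◁ p ⟧ c) ⟩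
  (U +ℋ B +ℋ C) +ℋ X +ℋ Y
    ≈⟨ solve 5 (λ U B C X Y → (((U ⊞ B) ⊞ C) ⊞ X) ⊞ Y ⊜ (((U ⊞ X) ⊞ Y) ⊞ B) ⊞ C) ≃-refl U B C X Y ⟩
  (U +ℋ X +ℋ Y) +ℋ B +ℋ C
    ≡⟨ cong (λ z → z +ℋ B +ℋ C) (◁ℋ-⟨⟩₃ a (p ⋆ʷ (b ◁ ε)) c ⟦ p ,, c ⟧ b ⟦ p ⟧ (c ⊕ b)) ⟨
  a ◁ℋ ((p ,, c) ⋆ʷ (b ◁ ε)) +ℋ B +ℋ C ∎
  where
  open ≃-Reasoning
  U = ⟨ a ◁ℋ (p ⋆ʷ (b ◁ ε)) , c ⟩ ; B = ⟦ b ◁ a ◁ p ,, c ⟧ ; C = ⟦ (a ⊕ b) ◁ p ,, c ⟧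
  X = ⟦ a ◁ p ,, c ,, b ⟧ ; Y = ⟦ a ◁ p ,, c ⊕ b ⟧
◁-⋆ʷ-◁ a b ε (q ,, d) = begin
  P +ℋ ⟨ (a ◁ ε) ⋆ʷ (b ◁ q) , d ⟩ +ℋ ⟨ ε ⋆ʷ (b ◁ q) , a ⊕ d ⟩
    ≈⟨ +ℋ-congʳ ⟨ ε ⋆ʷ (b ◁ q) , a ⊕ d ⟩ (+ℋ-congˡ P (⟨⟩-cong d (◁-⋆ʷ-◁ a b ε q))) ⟩
  P +ℋ ⟨ a ◁ℋ (ε ⋆ʷ (b ◁ q)) +ℋ b ◁ℋ ((a ◁ ε) ⋆ʷ q) +ℋ (a ⊕ b) ◁ℋ (ε ⋆ʷ q) , d ⟩
    +ℋ ⟨ ε ⋆ʷ (b ◁ q) , a ⊕ d ⟩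
    ≡⟨ cong (λ z → P +ℋ z +ℋ ⟨ ε ⋆ʷ (b ◁ q) , a ⊕ d ⟩)
         (⟨⟩-+ℋ₃ (a ◁ℋ (ε ⋆ʷ (b ◁ q))) (b ◁ℋ ((a ◁ ε) ⋆ʷ q)) ((a ⊕ b) ◁ℋ (ε ⋆ʷ q)) d) ⟩
  P +ℋ (⟨ a ◁ℋ (ε ⋆ʷ (b ◁ q)) , d ⟩ +ℋ Q +ℋ ⟨ (a ⊕ b) ◁ℋ (ε ⋆ʷ q) , d ⟩) +ℋ ⟨ ε ⋆ʷ (b ◁ q) , a ⊕ d ⟩
    ≡⟨ cong₂ (λ s t → P +ℋ (⟨ a ◁ℋ s , d ⟩ +ℋ Q +ℋ ⟨ (a ⊕ b) ◁ℋ t , d ⟩) +ℋ ⟨ s , a ⊕ d ⟩)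
         (ε-⋆ʷ (b ◁ q)) (ε-⋆ʷ q) ⟩
  P +ℋ (U +ℋ Q +ℋ V) +ℋ W
    ≈⟨ solve 5 (λ P U Q V W → (P ⊞ ((U ⊞ Q) ⊞ V)) ⊞ W ⊜ (U ⊞ ((P ⊞ Q) ⊞ W)) ⊞ V) ≃-refl P U Q V W ⟩
  U +ℋ (P +ℋ Q +ℋ W) +ℋ V
    ≡⟨ cong (λ z → U +ℋ z +ℋ V) (trans (◁ℋ-⟨⟩₃ b ⟦ q ,, d ⟧ a ((a ◁ ε) ⋆ʷ q) d (ε ⋆ʷ q) (a ⊕ d))
         (cong (λ t → P +ℋ Q +ℋ ⟨ b ◁ℋ t , a ⊕ d ⟩) (ε-⋆ʷ q))) ⟨
  U +ℋ b ◁ℋ ((a ◁ ε) ⋆ʷ (q ,, d)) +ℋ V ∎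
  where
  open ≃-Reasoning
  P = ⟦ b ◁ q ,, d ,, a ⟧ ; Q = ⟨ b ◁ℋ ((a ◁ ε) ⋆ʷ q) , d ⟩
  U = ⟦ a ◁ b ◁ q ,, d ⟧ ; V = ⟦ (a ⊕ b) ◁ q ,, d ⟧ ; W = ⟦ b ◁ q ,, a ⊕ d ⟧
◁-⋆ʷ-◁ a b (p ,, c) (q ,, d) = begin
  ⟨ (a ◁ p) ⋆ʷ (b ◁ q ,, d) , c ⟩ +ℋ ⟨ (a ◁ p ,, c) ⋆ʷ (b ◁ q) , d ⟩ +ℋ ⟨ (a ◁ p) ⋆ʷ (b ◁ q) , c ⊕ d ⟩
    ≈⟨ +ℋ-cong (+ℋ-cong (⟨⟩-cong c (◁-⋆ʷ-◁ a b p (q ,, d))) (⟨⟩-cong d (◁-⋆ʷ-◁ a b (p ,, c) q)))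
                (⟨⟩-cong (c ⊕ d) (◁-⋆ʷ-◁ a b p q)) ⟩
  ⟨ a ◁ℋ X₁ +ℋ b ◁ℋ Y₁ +ℋ (a ⊕ b) ◁ℋ Z₁ , c ⟩ +ℋ ⟨ a ◁ℋ X₂ +ℋ b ◁ℋ Y₂ +ℋ (a ⊕ b) ◁ℋ Z₂ , d ⟩
    +ℋ ⟨ a ◁ℋ X₃ +ℋ b ◁ℋ Y₃ +ℋ (a ⊕ b) ◁ℋ Z₃ , c ⊕ d ⟩
    ≡⟨ cong₂ _+ℋ_ (cong₂ _+ℋ_ (⟨⟩-+ℋ₃ (a ◁ℋ X₁) (b ◁ℋ Y₁) ((a ⊕ b) ◁ℋ Z₁) c)
                               (⟨⟩-+ℋ₃ (a ◁ℋ X₂) (b ◁ℋ Y₂) ((a ⊕ b) ◁ℋ Z₂) d))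
                               (⟨⟩-+ℋ₃ (a ◁ℋ X₃) (b ◁ℋ Y₃) ((a ⊕ b) ◁ℋ Z₃) (c ⊕ d)) ⟩
  (x₁ +ℋ y₁ +ℋ z₁) +ℋ (x₂ +ℋ y₂ +ℋ z₂) +ℋ (x₃ +ℋ y₃ +ℋ z₃)
    ≈⟨ +ℋ-transpose x₁ y₁ z₁ x₂ y₂ z₂ x₃ y₃ z₃ ⟩
  (x₁ +ℋ x₂ +ℋ x₃) +ℋ (y₁ +ℋ y₂ +ℋ y₃) +ℋ (z₁ +ℋ z₂ +ℋ z₃)
    ≡⟨ cong₂ _+ℋ_ (cong₂ _+ℋ_ (◁ℋ-⟨⟩₃ a X₁ c X₂ d X₃ (c ⊕ d)) (◁ℋ-⟨⟩₃ b Y₁ c Y₂ d Y₃ (c ⊕ d)))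
                               (◁ℋ-⟨⟩₃ (a ⊕ b) Z₁ c Z₂ d Z₃ (c ⊕ d)) ⟨
  a ◁ℋ ((p ,, c) ⋆ʷ (b ◁ q ,, d)) +ℋ b ◁ℋ ((a ◁ p ,, c) ⋆ʷ (q ,, d)) +ℋ (a ⊕ b) ◁ℋ ((p ,, c) ⋆ʷ (q ,, d)) ∎
  where
  open ≃-Reasoning
  X₁ = p ⋆ʷ (b ◁ q ,, d) ; Y₁ = (a ◁ p) ⋆ʷ (q ,, d) ; Z₁ = p ⋆ʷ (q ,, d)
  X₂ = (p ,, c) ⋆ʷ (b ◁ q) ; Y₂ = (a ◁ p ,, c) ⋆ʷ q ; Z₂ = (p ,, c) ⋆ʷ q
  X₃ = p ⋆ʷ (b ◁ q) ; Y₃ = (a ◁ p) ⋆ʷ q ; Z₃ = p ⋆ʷ q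
  x₁ = ⟨ a ◁ℋ X₁ , c ⟩ ; y₁ = ⟨ b ◁ℋ Y₁ , c ⟩ ; z₁ = ⟨ (a ⊕ b) ◁ℋ Z₁ , c ⟩
  x₂ = ⟨ a ◁ℋ X₂ , d ⟩ ; y₂ = ⟨ b ◁ℋ Y₂ , d ⟩ ; z₂ = ⟨ (a ⊕ b) ◁ℋ Z₂ , d ⟩
  x₃ = ⟨ a ◁ℋ X₃ , c ⊕ d ⟩ ; y₃ = ⟨ b ◁ℋ Y₃ , c ⊕ d ⟩ ; z₃ = ⟨ (a ⊕ b) ◁ℋ Z₃ , c ⊕ d ⟩

-- Alternating sums

-- alternating G R (d₁ ∷ ⋯ ∷ dₖ) = Σⱼ (-1)ʲ G (dⱼ ∷ ⋯ ∷ d₁ ∷ R) (dⱼ₊₁ ∷ ⋯ ∷ dₖ)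
alternating : (List S → List S → ℋ) → List S → List S → ℋ
alternating G R []      = G R []
alternating G R (b ∷ D) = G R (b ∷ D) −ℋ alternating G (b ∷ R) D

alternating-⋆ˡ : ∀ x {G G′ : List S → List S → ℋ} → (∀ R D → G′ R D ≃ x ⋆ G R D) →
                 ∀ R D → alternating G′ R D ≃ x ⋆ alternating G R D
alternating-⋆ˡ x G′≃x⋆G R []      = G′≃x⋆G R []
alternating-⋆ˡ x {G} G′≃x⋆G R (b ∷ D) =
  ≃-trans (−ℋ-cong (G′≃x⋆G R (b ∷ D)) (alternating-⋆ˡ x G′≃x⋆G (b ∷ R) D))
          (≃-sym (⋆-−ℋ x (G R (b ∷ D)) (alternating G (b ∷ R) D)))

module _ {G G′ : List S → List S → ℋ} (u v : S)
         (base : ∀ R → G′ R [] ≃ ⟨ G R [] , u ⟩)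
         (step : ∀ R D → G′ R (D ∷ʳ v) ≃ ⟨ G R (D ∷ʳ v) , u ⟩ +ℋ ⟨ G′ R D , v ⟩ +ℋ ⟨ G R D , u ⊕ v ⟩)
         where

  alternating-∷ʳ : ∀ R D → alternating G′ R (D ∷ʳ v)
    ≃ ⟨ alternating G R (D ∷ʳ v) , u ⟩ +ℋ ⟨ alternating G′ R D , v ⟩ +ℋ ⟨ alternating G R D , u ⊕ v ⟩
  alternating-∷ʳ R [] = begin
    G′ R (v ∷ []) −ℋ G′ (v ∷ R) []
      ≈⟨ −ℋ-cong (step R []) (base (v ∷ R)) ⟩
    (⟨ G R (v ∷ []) , u ⟩ +ℋ ⟨ G′ R [] , v ⟩ +ℋ ⟨ G R [] , u ⊕ v ⟩) −ℋ ⟨ G (v ∷ R) [] , u ⟩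
      ≈⟨ −ℋ-+ℋ₃ˡ ⟨ G R (v ∷ []) , u ⟩ ⟨ G′ R [] , v ⟩ ⟨ G R [] , u ⊕ v ⟩ ⟨ G (v ∷ R) [] , u ⟩ ⟩
    (⟨ G R (v ∷ []) , u ⟩ −ℋ ⟨ G (v ∷ R) [] , u ⟩) +ℋ ⟨ G′ R [] , v ⟩ +ℋ ⟨ G R [] , u ⊕ v ⟩
      ≈⟨ +ℋ-congʳ ⟨ G R [] , u ⊕ v ⟩ (+ℋ-congʳ ⟨ G′ R [] , v ⟩
           (≃-sym (⟨⟩-−ℋ (G R (v ∷ [])) (G (v ∷ R) []) u))) ⟩
    ⟨ G R (v ∷ []) −ℋ G (v ∷ R) [] , u ⟩ +ℋ ⟨ G′ R [] , v ⟩ +ℋ ⟨ G R [] , u ⊕ v ⟩ ∎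
    where open ≃-Reasoning
  alternating-∷ʳ R (c ∷ D) = begin
    G′ R (c ∷ D ∷ʳ v) −ℋ alternating G′ (c ∷ R) (D ∷ʳ v)
      ≈⟨ −ℋ-cong (step R (c ∷ D)) (alternating-∷ʳ (c ∷ R) D) ⟩
    (⟨ G R (c ∷ D ∷ʳ v) , u ⟩ +ℋ ⟨ G′ R (c ∷ D) , v ⟩ +ℋ ⟨ G R (c ∷ D) , u ⊕ v ⟩)
      −ℋ (⟨ A , u ⟩ +ℋ ⟨ B , v ⟩ +ℋ ⟨ C , u ⊕ v ⟩)
      ≈⟨ −ℋ-+ℋ₃ ⟨ G R (c ∷ D ∷ʳ v) , u ⟩ ⟨ G′ R (c ∷ D) , v ⟩ ⟨ G R (c ∷ D) , u ⊕ v ⟩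
                ⟨ A , u ⟩ ⟨ B , v ⟩ ⟨ C , u ⊕ v ⟩ ⟩
    (⟨ G R (c ∷ D ∷ʳ v) , u ⟩ −ℋ ⟨ A , u ⟩) +ℋ (⟨ G′ R (c ∷ D) , v ⟩ −ℋ ⟨ B , v ⟩)
      +ℋ (⟨ G R (c ∷ D) , u ⊕ v ⟩ −ℋ ⟨ C , u ⊕ v ⟩)
      ≈⟨ ≃-sym (+ℋ-cong (+ℋ-cong (⟨⟩-−ℋ (G R (c ∷ D ∷ʳ v)) A u) (⟨⟩-−ℋ (G′ R (c ∷ D)) B v))
                                 (⟨⟩-−ℋ (G R (c ∷ D)) C (u ⊕ v))) ⟩
    ⟨ G R (c ∷ D ∷ʳ v) −ℋ A , u ⟩ +ℋ ⟨ G′ R (c ∷ D) −ℋ B , v ⟩ +ℋ ⟨ G R (c ∷ D) −ℋ C , u ⊕ v ⟩ ∎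
    where
    open ≃-Reasoning
    A = alternating G (c ∷ R) (D ∷ʳ v) ; B = alternating G′ (c ∷ R) D ; C = alternating G (c ∷ R) D

-- reverseAcc E xs = reverse xs ++ E; with E = [] this is the reverse used in rhs.
sign-sum-alternating : ∀ (G : List S → List S → ℋ) E b D →
  sumℋ (map (λ k → sign k ·ℋ G (reverseAcc E (take (suc k) (b ∷ D))) (drop (suc k) (b ∷ D)))
            (upTo (suc (length D))))
    ≃ alternating G (b ∷ E) D
sign-sum-alternating G E b []      = ≃-trans (+ℋ-identityʳ _) (·ℋ-identityˡ (G (b ∷ E) []))
sign-sum-alternating G E b (c ∷ D) = begin
  φ 0 +ℋ sumℋ (map φ (applyUpTo suc (suc (length D))))
    ≡⟨ cong (λ ks → φ 0 +ℋ concat ks)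
         (trans (List.map-applyUpTo suc φ n) (sym (List.map-applyUpTo id (φ ∘ suc) n))) ⟩
  φ 0 +ℋ sumℋ (map (λ k → (- sign k) ·ℋ ψ k) (upTo (suc (length D))))
    ≈⟨ +ℋ-cong (·ℋ-identityˡ (G (b ∷ E) (c ∷ D)))
               (≃-trans (sumℋ-negate sign ψ (upTo n))
                        (·ℋ-cong (- 1ℚ) (sign-sum-alternating G (b ∷ E) c D))) ⟩
  G (b ∷ E) (c ∷ D) −ℋ alternating G (c ∷ b ∷ E) D ∎
  where
  open ≃-Reasoning
  n = suc (length D)
  φ ψ : ℕ → ℋ
  φ k = sign k ·ℋ G (reverseAcc E (take (suc k) (b ∷ c ∷ D))) (drop (suc k) (b ∷ c ∷ D))
  ψ k = G (reverseAcc (b ∷ E) (take (suc k) (c ∷ D))) (drop (suc k) (c ∷ D))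

⊕-head : S → List S → List S
⊕-head b []      = []
⊕-head b (a ∷ m) = (b ⊕ a) ∷ m

merges′-⊕ : ∀ b a r → merges′ (b ⊕ a) r ≡ map (⊕-head b) (merges′ a r)
merges′-⊕ b a []      = refl
merges′-⊕ b a (c ∷ r) = begin
  map ((b ⊕ a) ∷_) (merges′ c r) ++ merges′ ((b ⊕ a) ⊕ c) r
    ≡⟨ cong₂ _++_ (List.map-∘ (merges′ c r))
         (trans (cong (λ x → merges′ x r) (⊕-assoc b a c)) (merges′-⊕ b (a ⊕ c) r)) ⟩
  map (⊕-head b) (map (a ∷_) (merges′ c r)) ++ map (⊕-head b) (merges′ (a ⊕ c) r)
    ≡⟨ List.map-++ (⊕-head b) (map (a ∷_) (merges′ c r)) (merges′ (a ⊕ c) r) ⟨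
  map (⊕-head b) (merges′ a (c ∷ r)) ∎
  where open ≡-Reasoning

sumℋ-merges′-cong : ∀ {g h : List S → ℋ} a r → (∀ a m → g (a ∷ m) ≃ h (a ∷ m)) →
  sumℋ (map g (merges′ a r)) ≃ sumℋ (map h (merges′ a r))
sumℋ-merges′-cong a []      g≃h = +ℋ-cong (g≃h a []) ≃-refl
sumℋ-merges′-cong {g} {h} a (b ∷ r) g≃h = begin
  sumℋ (map g (map (a ∷_) (merges′ b r) ++ merges′ (a ⊕ b) r))
    ≡⟨ trans (sumℋ-++ g (map (a ∷_) (merges′ b r)) (merges′ (a ⊕ b) r))
             (cong (_+ℋ sumℋ (map g (merges′ (a ⊕ b) r))) (sumℋ-map g (a ∷_) (merges′ b r))) ⟩
  sumℋ (map (g ∘ (a ∷_)) (merges′ b r)) +ℋ sumℋ (map g (merges′ (a ⊕ b) r))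
    ≈⟨ +ℋ-cong (sumℋ-cong (merges′ b r) (g≃h a)) (sumℋ-merges′-cong (a ⊕ b) r g≃h) ⟩
  sumℋ (map (h ∘ (a ∷_)) (merges′ b r)) +ℋ sumℋ (map h (merges′ (a ⊕ b) r))
    ≡⟨ trans (sumℋ-++ h (map (a ∷_) (merges′ b r)) (merges′ (a ⊕ b) r))
             (cong (_+ℋ sumℋ (map h (merges′ (a ⊕ b) r))) (sumℋ-map h (a ∷_) (merges′ b r))) ⟨
  sumℋ (map h (map (a ∷_) (merges′ b r) ++ merges′ (a ⊕ b) r)) ∎
  where open ≃-Reasoning

mergeSum : List S → ℋ
mergeSum R = sumℋ (map (λ m → ⟦ word m ⟧) (merges R))

-- The words of (a ∷ m) * D whose first letter is a itself.
lead : List S → List S → ℋ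
lead D []      = []
lead D (a ∷ m) = a ◁ℋ (⟦ word m ⟧ ⋆ ⟦ word D ⟧)

leadSum : List S → List S → ℋ
leadSum R D = sumℋ (map (lead D) (merges R))

mergeProduct : List S → List S → ℋ
mergeProduct R D = mergeSum R ⋆ ⟦ word D ⟧

⟦⟧-⋆-⟦∷⟧ : ∀ m b D →
  ⟦ word m ⟧ ⋆ ⟦ word (b ∷ D) ⟧ ≃ lead (b ∷ D) m +ℋ lead D (b ∷ m) +ℋ lead D (⊕-head b m)
⟦⟧-⋆-⟦∷⟧ [] b D = begin
  ⟦ ε ⟧ ⋆ ⟦ word (b ∷ D) ⟧       ≈⟨ ⟦ε⟧-⋆ _ ⟩
  ⟦ word (b ∷ D) ⟧               ≡⟨ cong ⟦_⟧ (word-∷ b D) ⟩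
  b ◁ℋ ⟦ word D ⟧                ≈⟨ ◁ℋ-cong b (⟦ε⟧-⋆ _) ⟨
  b ◁ℋ (⟦ ε ⟧ ⋆ ⟦ word D ⟧)      ≡⟨ List.++-identityʳ _ ⟨
  [] +ℋ b ◁ℋ (⟦ ε ⟧ ⋆ ⟦ word D ⟧) +ℋ [] ∎
  where open ≃-Reasoning
⟦⟧-⋆-⟦∷⟧ (a ∷ m) b D = begin
  ⟦ word (a ∷ m) ⟧ ⋆ ⟦ word (b ∷ D) ⟧
    ≈⟨ ⟦⟧-⋆-⟦⟧ (word (a ∷ m)) (word (b ∷ D)) ⟩
  word (a ∷ m) ⋆ʷ word (b ∷ D)
    ≡⟨ cong₂ _⋆ʷ_ (word-∷ a m) (word-∷ b D) ⟩
  (a ◁ word m) ⋆ʷ (b ◁ word D)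
    ≈⟨ ◁-⋆ʷ-◁ a b (word m) (word D) ⟩
  a ◁ℋ (word m ⋆ʷ (b ◁ word D)) +ℋ b ◁ℋ ((a ◁ word m) ⋆ʷ word D) +ℋ (a ⊕ b) ◁ℋ (word m ⋆ʷ word D)
    ≡⟨ cong₂ (λ x y → a ◁ℋ (word m ⋆ʷ x) +ℋ b ◁ℋ (y ⋆ʷ word D) +ℋ (a ⊕ b) ◁ℋ (word m ⋆ʷ word D))
         (sym (word-∷ b D)) (sym (word-∷ a m)) ⟩
  a ◁ℋ (word m ⋆ʷ word (b ∷ D)) +ℋ b ◁ℋ (word (a ∷ m) ⋆ʷ word D) +ℋ (a ⊕ b) ◁ℋ (word m ⋆ʷ word D)
    ≈⟨ +ℋ-cong (+ℋ-cong (◁ℋ-cong a (≃-sym (⟦⟧-⋆-⟦⟧ (word m) (word (b ∷ D)))))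
                         (◁ℋ-cong b (≃-sym (⟦⟧-⋆-⟦⟧ (word (a ∷ m)) (word D)))))
               (≃-trans (≡⇒≃ (cong (_◁ℋ (word m ⋆ʷ word D)) (⊕-comm a b)))
                        (◁ℋ-cong (b ⊕ a) (≃-sym (⟦⟧-⋆-⟦⟧ (word m) (word D))))) ⟩
  lead (b ∷ D) (a ∷ m) +ℋ lead D (b ∷ a ∷ m) +ℋ lead D ((b ⊕ a) ∷ m) ∎
  where open ≃-Reasoning

mergeProduct-[] : ∀ r R → mergeProduct (r ∷ R) [] ≃ leadSum (r ∷ R) []
mergeProduct-[] r R =
  ≃-trans (⋆-⟦ε⟧ (mergeSum (r ∷ R))) (sumℋ-merges′-cong r R (λ a m →
    ≃-trans (≡⇒≃ (cong ⟦_⟧ (word-∷ a m))) (◁ℋ-cong a (≃-sym (⋆-⟦ε⟧ ⟦ word m ⟧)))))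

mergeProduct-∷ : ∀ r R b D →
  mergeProduct (r ∷ R) (b ∷ D) ≃ leadSum (r ∷ R) (b ∷ D) +ℋ leadSum (b ∷ r ∷ R) D
mergeProduct-∷ r R b D = begin
  mergeSum (r ∷ R) ⋆ ⟦ word (b ∷ D) ⟧
    ≈⟨ sumℋ-⋆ (λ m → ⟦ word m ⟧) M ⟦ word (b ∷ D) ⟧ ⟩
  sumℋ (map (λ m → ⟦ word m ⟧ ⋆ ⟦ word (b ∷ D) ⟧) M)
    ≈⟨ sumℋ-cong M (λ m → ⟦⟧-⋆-⟦∷⟧ m b D) ⟩
  sumℋ (map (λ m → lead (b ∷ D) m +ℋ lead D (b ∷ m) +ℋ lead D (⊕-head b m)) M)
    ≈⟨ ≃-trans (sumℋ-+ℋ _ (lead D ∘ ⊕-head b) M)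
               (+ℋ-congʳ Σ₃ (sumℋ-+ℋ (lead (b ∷ D)) (lead D ∘ (b ∷_)) M)) ⟩
  L +ℋ Σ₂ +ℋ Σ₃
    ≈⟨ +ℋ-assoc L Σ₂ Σ₃ ⟩
  L +ℋ (Σ₂ +ℋ Σ₃)
    ≡⟨ cong (L +ℋ_) (cong₂ _+ℋ_ (sumℋ-map (lead D) (b ∷_) M) (sumℋ-map (lead D) (⊕-head b) M)) ⟨
  L +ℋ (sumℋ (map (lead D) (map (b ∷_) M)) +ℋ sumℋ (map (lead D) (map (⊕-head b) M)))
    ≡⟨ cong (λ M′ → L +ℋ (sumℋ (map (lead D) (map (b ∷_) M)) +ℋ sumℋ (map (lead D) M′)))
            (merges′-⊕ b r R) ⟨
  L +ℋ (sumℋ (map (lead D) (map (b ∷_) M)) +ℋ sumℋ (map (lead D) (merges′ (b ⊕ r) R)))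
    ≡⟨ cong (L +ℋ_) (sumℋ-++ (lead D) (map (b ∷_) M) (merges′ (b ⊕ r) R)) ⟨
  L +ℋ leadSum (b ∷ r ∷ R) D ∎
  where
  open ≃-Reasoning
  M = merges′ r R
  L = leadSum (r ∷ R) (b ∷ D)
  Σ₂ = sumℋ (map (lead D ∘ (b ∷_)) M)
  Σ₃ = sumℋ (map (lead D ∘ ⊕-head b) M)

alternating-mergeProduct-leadSum : ∀ D r R → alternating mergeProduct (r ∷ R) D ≃ leadSum (r ∷ R) D
alternating-mergeProduct-leadSum []      r R = mergeProduct-[] r R
alternating-mergeProduct-leadSum (b ∷ D) r R =
  ≃-trans (−ℋ-cong (mergeProduct-∷ r R b D) (alternating-mergeProduct-leadSum D b (r ∷ R)))
          (+ℋ-−ℋ-cancel (leadSum (r ∷ R) (b ∷ D)) (leadSum (b ∷ r ∷ R) D))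

alternating-mergeProduct-word : ∀ v D → alternating mergeProduct (v ∷ []) D ≃ ⟦ word (v ∷ D) ⟧
alternating-mergeProduct-word v D = begin
  alternating mergeProduct (v ∷ []) D  ≈⟨ alternating-mergeProduct-leadSum D v [] ⟩
  v ◁ℋ (⟦ ε ⟧ ⋆ ⟦ word D ⟧) +ℋ []      ≈⟨ +ℋ-congʳ [] (◁ℋ-cong v (⟦ε⟧-⋆ ⟦ word D ⟧)) ⟩
  ⟦ v ◁ word D ⟧ +ℋ []                  ≡⟨ cong (λ α → ⟦ α ⟧ +ℋ []) (word-∷ v D) ⟨
  ⟦ word (v ∷ D) ⟧ +ℋ []                ≈⟨ +ℋ-identityʳ _ ⟩
  ⟦ word (v ∷ D) ⟧                      ∎
  where open ≃-Reasoning

module Expansion (w : Word) (u : S) where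

  term₀ term : List S → List S → ℋ
  term₀ R D = (⟦ w ⟧ ⋆ mergeSum R) ⋆ ⟦ word D ⟧
  term  R D = ⟨ ⟦ w ⟧ ⋆ mergeSum R , u ⟩ ⋆ ⟦ word D ⟧

  alternating-term₀ : ∀ v D → alternating term₀ (v ∷ []) D ≃ ⟦ w ⟧ ⋆ ⟦ word (v ∷ D) ⟧
  alternating-term₀ v D =
    ≃-trans (alternating-⋆ˡ ⟦ w ⟧ (λ R D → ⋆-assoc ⟦ w ⟧ (mergeSum R) ⟦ word D ⟧) (v ∷ []) D)
            (⋆-cong (≃-refl {⟦ w ⟧}) (alternating-mergeProduct-word v D))

  term-[] : ∀ R → term R [] ≃ ⟨ term₀ R [] , u ⟩
  term-[] R = ≃-trans (⋆-⟦ε⟧ _) (⟨⟩-cong u (≃-sym (⋆-⟦ε⟧ (⟦ w ⟧ ⋆ mergeSum R))))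

  term-∷ʳ : ∀ v R D →
    term R (D ∷ʳ v) ≃ ⟨ term₀ R (D ∷ʳ v) , u ⟩ +ℋ ⟨ term R D , v ⟩ +ℋ ⟨ term₀ R D , u ⊕ v ⟩
  term-∷ʳ v R D = begin
    ⟨ Y , u ⟩ ⋆ ⟦ word (D ∷ʳ v) ⟧
      ≡⟨ cong (⟨ Y , u ⟩ ⋆_) (⟦word-∷ʳ⟧ D v) ⟩
    ⟨ Y , u ⟩ ⋆ ⟨ ⟦ word D ⟧ , v ⟩
      ≈⟨ ⟨⟩-⋆-⟨⟩ Y u ⟦ word D ⟧ v ⟩
    ⟨ Y ⋆ ⟨ ⟦ word D ⟧ , v ⟩ , u ⟩ +ℋ ⟨ term R D , v ⟩ +ℋ ⟨ term₀ R D , u ⊕ v ⟩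
      ≡⟨ cong (λ z → ⟨ Y ⋆ z , u ⟩ +ℋ ⟨ term R D , v ⟩ +ℋ ⟨ term₀ R D , u ⊕ v ⟩) (⟦word-∷ʳ⟧ D v) ⟨
    ⟨ term₀ R (D ∷ʳ v) , u ⟩ +ℋ ⟨ term R D , v ⟩ +ℋ ⟨ term₀ R D , u ⊕ v ⟩ ∎
    where
    open ≃-Reasoning
    Y = ⟦ w ⟧ ⋆ mergeSum R

  expansion : ∀ v₁ {vs} → Reverse vs →
    ⟦ w ,, u ⟧ ⋆ ⟦ word (v₁ ∷ vs) ⟧
      ≃ ⟦ (w ,, u) ++ʷ (v₁ ∷ vs) ⟧ +ℋ ⟦ (w ,, u ⊕ v₁) ++ʷ vs ⟧ +ℋ alternating term (v₁ ∷ []) vs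
  expansion v₁ [] = begin
    ⟨ ⟦ w ⟧ , u ⟩ ⋆ ⟨ ⟦ ε ⟧ , v₁ ⟩
      ≈⟨ ⟨⟩-⋆-⟨⟩ ⟦ w ⟧ u ⟦ ε ⟧ v₁ ⟩
    ⟨ ⟦ w ⟧ ⋆ ⟦ ε ,, v₁ ⟧ , u ⟩ +ℋ ⟨ ⟦ w ,, u ⟧ ⋆ ⟦ ε ⟧ , v₁ ⟩ +ℋ ⟨ ⟦ w ⟧ ⋆ ⟦ ε ⟧ , u ⊕ v₁ ⟩
      ≈⟨ +ℋ-cong (+ℋ-congˡ ⟨ ⟦ w ⟧ ⋆ ⟦ ε ,, v₁ ⟧ , u ⟩ (⟨⟩-cong v₁ (⋆-⟦ε⟧ ⟦ w ,, u ⟧)))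
                 (⟨⟩-cong (u ⊕ v₁) (⋆-⟦ε⟧ ⟦ w ⟧)) ⟩
    ⟨ ⟦ w ⟧ ⋆ ⟦ ε ,, v₁ ⟧ , u ⟩ +ℋ ⟦ w ,, u ,, v₁ ⟧ +ℋ ⟦ w ,, u ⊕ v₁ ⟧
      ≈⟨ solve 3 (λ x y z → (x ⊞ y) ⊞ z ⊜ (y ⊞ z) ⊞ x) ≃-refl
           ⟨ ⟦ w ⟧ ⋆ ⟦ ε ,, v₁ ⟧ , u ⟩ ⟦ w ,, u ,, v₁ ⟧ ⟦ w ,, u ⊕ v₁ ⟧ ⟩
    ⟦ w ,, u ,, v₁ ⟧ +ℋ ⟦ w ,, u ⊕ v₁ ⟧ +ℋ ⟨ ⟦ w ⟧ ⋆ ⟦ ε ,, v₁ ⟧ , u ⟩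
      ≈⟨ +ℋ-congˡ (⟦ w ,, u ,, v₁ ⟧ +ℋ ⟦ w ,, u ⊕ v₁ ⟧)
           (≃-sym (≃-trans (term-[] (v₁ ∷ [])) (⟨⟩-cong u (alternating-term₀ v₁ [])))) ⟩
    ⟦ w ,, u ,, v₁ ⟧ +ℋ ⟦ w ,, u ⊕ v₁ ⟧ +ℋ term (v₁ ∷ []) [] ∎
    where open ≃-Reasoning
  expansion v₁ (vs ∶ rs ∶ʳ v) = begin
    ⟨ ⟦ w ⟧ , u ⟩ ⋆ ⟦ word (V ∷ʳ v) ⟧
      ≡⟨ cong (⟨ ⟦ w ⟧ , u ⟩ ⋆_) (⟦word-∷ʳ⟧ V v) ⟩
    ⟨ ⟦ w ⟧ , u ⟩ ⋆ ⟨ ⟦ word V ⟧ , v ⟩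
      ≈⟨ ⟨⟩-⋆-⟨⟩ ⟦ w ⟧ u ⟦ word V ⟧ v ⟩
    ⟨ ⟦ w ⟧ ⋆ ⟨ ⟦ word V ⟧ , v ⟩ , u ⟩ +ℋ ⟨ ⟦ w ,, u ⟧ ⋆ ⟦ word V ⟧ , v ⟩ +ℋ ⟨ ⟦ w ⟧ ⋆ ⟦ word V ⟧ , u ⊕ v ⟩
      ≈⟨ +ℋ-cong (+ℋ-cong
           (⟨⟩-cong u (≃-trans (≡⇒≃ (cong (⟦ w ⟧ ⋆_) (sym (⟦word-∷ʳ⟧ V v))))
                               (≃-sym (alternating-term₀ v₁ (vs ∷ʳ v)))))
           (⟨⟩-cong v (expansion v₁ rs)))
           (⟨⟩-cong (u ⊕ v) (≃-sym (alternating-term₀ v₁ vs))) ⟩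
    p +ℋ ⟨ ⟦ (w ,, u) ++ʷ V ⟧ +ℋ ⟦ (w ,, u ⊕ v₁) ++ʷ vs ⟧ +ℋ alternating term (v₁ ∷ []) vs , v ⟩ +ℋ q
      ≡⟨ cong (λ z → p +ℋ z +ℋ q) (⟨⟩-+ℋ₃ ⟦ (w ,, u) ++ʷ V ⟧ ⟦ (w ,, u ⊕ v₁) ++ʷ vs ⟧ _ v) ⟩
    p +ℋ (a +ℋ b +ℋ t) +ℋ q
      ≈⟨ solve 5 (λ p a b t q → (p ⊞ ((a ⊞ b) ⊞ t)) ⊞ q ⊜ (a ⊞ b) ⊞ ((p ⊞ t) ⊞ q)) ≃-refl p a b t q ⟩
    a +ℋ b +ℋ (p +ℋ t +ℋ q)
      ≈⟨ +ℋ-congˡ (a +ℋ b) (≃-sym (alternating-∷ʳ {term₀} {term} u v term-[] (term-∷ʳ v) (v₁ ∷ []) vs)) ⟩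
    a +ℋ b +ℋ alternating term (v₁ ∷ []) (vs ∷ʳ v)
      ≡⟨ cong₂ (λ α β → ⟦ α ⟧ +ℋ ⟦ β ⟧ +ℋ alternating term (v₁ ∷ []) (vs ∷ʳ v))
           (++ʷ-∷ʳ (w ,, u) V v) (++ʷ-∷ʳ (w ,, u ⊕ v₁) vs v) ⟨
    ⟦ (w ,, u) ++ʷ (V ∷ʳ v) ⟧ +ℋ ⟦ (w ,, u ⊕ v₁) ++ʷ (vs ∷ʳ v) ⟧ +ℋ alternating term (v₁ ∷ []) (vs ∷ʳ v) ∎
    where
    open ≃-Reasoning
    V = v₁ ∷ vs
    p = ⟨ alternating term₀ (v₁ ∷ []) (vs ∷ʳ v) , u ⟩
    q = ⟨ alternating term₀ (v₁ ∷ []) vs , u ⊕ v ⟩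
    a = ⟨ ⟦ (w ,, u) ++ʷ V ⟧ , v ⟩
    b = ⟨ ⟦ (w ,, u ⊕ v₁) ++ʷ vs ⟧ , v ⟩
    t = ⟨ alternating term (v₁ ∷ []) vs , v ⟩

  term-as-sum : ∀ R D → sumℋ (map (λ m → ⟨ ⟦ w ⟧ ⋆ ⟦ word m ⟧ , u ⟩ ⋆ ⟦ word D ⟧) (merges R)) ≃ term R D
  term-as-sum R D = begin
    sumℋ (map (λ m → ⟨ ⟦ w ⟧ ⋆ ⟦ word m ⟧ , u ⟩ ⋆ ⟦ word D ⟧) M)
      ≈⟨ sumℋ-⋆ (λ m → ⟨ ⟦ w ⟧ ⋆ ⟦ word m ⟧ , u ⟩) M ⟦ word D ⟧ ⟨
    sumℋ (map (λ m → ⟨ ⟦ w ⟧ ⋆ ⟦ word m ⟧ , u ⟩) M) ⋆ ⟦ word D ⟧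
      ≈⟨ ⋆-cong (⟨⟩-sumℋ (λ m → ⟦ w ⟧ ⋆ ⟦ word m ⟧) M u) (≃-refl {⟦ word D ⟧}) ⟨
    ⟨ sumℋ (map (λ m → ⟦ w ⟧ ⋆ ⟦ word m ⟧) M) , u ⟩ ⋆ ⟦ word D ⟧
      ≈⟨ ⋆-cong (⟨⟩-cong u (⋆-sumℋ ⟦ w ⟧ (λ m → ⟦ word m ⟧) M)) (≃-refl {⟦ word D ⟧}) ⟨
    term R D ∎
    where
    open ≃-Reasoning
    M = merges R

proposition1p10 : (w : Word) (u v₁ : S) (vs : List S) →
    ⟦ w ,, u ⟧ ⋆ ⟦ word (v₁ ∷ vs) ⟧ ≈ℋ rhs w u (v₁ ∷ vs)
proposition1p10 w u v₁ vs = ≃⇒≈ℋ (begin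
  ⟦ w ,, u ⟧ ⋆ ⟦ word V ⟧
    ≈⟨ expansion v₁ (reverseView vs) ⟩
  ⟦ (w ,, u) ++ʷ V ⟧ +ℋ ⟦ (w ,, u ⊕ v₁) ++ʷ vs ⟧ +ℋ alternating term (v₁ ∷ []) vs
    ≈⟨ +ℋ-congˡ (⟦ (w ,, u) ++ʷ V ⟧ +ℋ ⟦ (w ,, u ⊕ v₁) ++ʷ vs ⟧) (≃-sym (≃-trans
         (sumℋ-cong {g = summand} (upTo (length V)) (λ k →
            ·ℋ-cong (sign k) (term-as-sum (reverseAcc [] (take (suc k) V)) (drop (suc k) V))))
         (sign-sum-alternating term [] v₁ vs))) ⟩
  rhs w u V ∎)
  where
  open Expansion w u
  open ≃-Reasoning
  V = v₁ ∷ vs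
  summand : ℕ → ℋ
  summand k = sign k ·ℋ sumℋ (map (λ m → ⟨ ⟦ w ⟧ ⋆ ⟦ word m ⟧ , u ⟩ ⋆ ⟦ word (drop (suc k) V) ⟧)
                                  (merges (reverseAcc [] (take (suc k) V))))
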